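{- Let $k$ be a positive integer, $A$ a finite set, $\mathbb{F}$ a field, and $\mathcal{P}$ a property of $k$-tuples of elements of $A$. Let $T:A^k\to\mathbb{F}$ and $f:\Pi_k\setminus\{\hat{1}\}\to\mathbb{F}$ be such that (1) $(x,\ldots,x)$ satisfies $\mathcal{P}$ for every $x\in A$; (2) $T(x_1,\ldots,x_k)=1$ if $(x_1,\ldots,x_k)$ satisfies $\mathcal{P}$, and $T(x_1,\ldots,x_k)=0$ otherwise; (3) for every $\pi\in\Pi_k\setminus\{\hat{1}\}$, if some $(x_1,\ldots,x_k)\in A^k$ with partition $\pi$ satisfies $\mathcal{P}$, then $f(\pi)=0$; (4) $\sum_{\pi\in\Pi_k,\ \pi<\hat{1}} f(\pi)\,\mu(\pi,\hat{1})\neq 0$. Then $|A|\le \operatorname{partition-rank}(I_f\cdot T)$, where $I_f\cdot T$ is the pointwise product.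
   Context: $\Pi_k$ is the set of set partitions of $\{1,\ldots,k\}$ ordered by refinement ($\pi'\le\pi$ if every block of $\pi'$ lies in a block of $\pi$), with minimum $\hat{0}$ (all singletons) and maximum $\hat{1}$ (one block). The Möbius function $\mu$ of $\Pi_k$: $\mu(x,x)=1$, $\mu(x,y)=-\sum_{x\le z<y}\mu(x,z)$ for $x<y$, $\mu(x,y)=0$ otherwise (integer values read in $\mathbb{F}$). For $\pi\in\Pi_k$, $\delta_\pi(x_1,\ldots,x_k)=1$ if $x_i=x_j$ whenever $i,j$ are in the same block of $\pi$, and $0$ otherwise. The partition of $(x_1,\ldots,x_k)$ is the partition of $\{1,\ldots,k\}$ in which $i,j$ share a block iff $x_i=x_j$. The partition indicator of $f$ is $I_f:A^k\to\mathbb{F}$, \[I_f(x_1,\ldots,x_k)=\sum_{\tau\in\Pi_k,\ \tau<\hat{1}}\Big(\sum_{\pi\le\tau} f(\pi)\mu(\pi,\tau)\Big)\delta_\tau(x_1,\ldots,x_k).\] A function $T:A^k\to\mathbb{F}$ has partition rank $1$ if there is a partition $\pi_1\cdots\pi_r$ of $\{1,\ldots,k\}$ with $r\ge2$ blocks and functions $T_i$ of the variables $(x_j)_{j\in\pi_i}$ with $T=\prod_i T_i$; the partition rank is the least number of partition-rank-$1$ functions summing to $T$. -}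

module Defs where

open import Level using (Level; _⊔_)
open import Algebra.Bundles using (CommutativeRing)
open import Data.Bool using (Bool; true; false; if_then_else_)
open import Data.Nat as ℕ using (ℕ; zero; suc; _≤_)
open import Data.Fin as Fin using (Fin)
open import Data.Fin.Properties as FinP using (all?)
open import Data.Integer as ℤ using (ℤ; +_; -[1+_])
open import Data.List using (List; []; _∷_; map; concatMap; filter; foldr; length; allFin)
open import Data.List.Relation.Unary.All using (All)
open import Data.Vec using (Vec; []; _∷_; lookup; replicate)
open import Data.Vec.Properties using (≡-dec)
open import Data.Product using (Σ; ∃; _×_; _,_)
open import Relation.Binary.PropositionalEquality using (_≡_; _≢_)
open import Relation.Nullary using (¬_; Dec; yes; no)
open import Relation.Nullary.Decidable using (_×-dec_; _→-dec_; ¬?; does)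
open import Relation.Unary using (Decidable)

record Field (c ℓ : Level) : Set (Level.suc (c ⊔ ℓ)) where
  field
    commutativeRing : CommutativeRing c ℓ
  open CommutativeRing commutativeRing public
  field
    1≉0     : ¬ (1# ≈ 0#)
    inverse : ∀ x → ¬ (x ≈ 0#) → Σ Carrier λ y → x * y ≈ 1#

-- A set partition is encoded by the vector π whose i-th entry is the
-- LEAST element of the block containing i.  The valid encodings are exactly
-- the vectors with  π[i] ≤ i  and  π[π[i]] ≡ π[i]  (this is a bijection
-- with the set partitions of Fin k).

Labels : ℕ → Set
Labels k = Vec (Fin k) k

IsSetPartition : ∀ {k} → Labels k → Set
IsSetPartition {k} π = ∀ (i : Fin k) →
  (lookup π i Fin.≤ i) × (lookup π (lookup π i) ≡ lookup π i)

isSetPartition? : ∀ {k} → Decidable (IsSetPartition {k})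
isSetPartition? π = all? λ i →
  (lookup π i Fin.≤? i) ×-dec (lookup π (lookup π i) Fin.≟ lookup π i)

SameBlock : ∀ {k} → Labels k → Fin k → Fin k → Set
SameBlock π i j = lookup π i ≡ lookup π j

_≼_ : ∀ {k} → Labels k → Labels k → Set
_≼_ {k} π′ π = ∀ (i j : Fin k) → SameBlock π′ i j → SameBlock π i j

_≼?_ : ∀ {k} (π′ π : Labels k) → Dec (π′ ≼ π)
π′ ≼? π = all? λ i → all? λ j →
  (lookup π′ i Fin.≟ lookup π′ j) →-dec (lookup π i Fin.≟ lookup π j)

_≺_ : ∀ {k} → Labels k → Labels k → Set
π′ ≺ π = (π′ ≼ π) × (π′ ≢ π)

_≺?_ : ∀ {k} (π′ π : Labels k) → Dec (π′ ≺ π)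
π′ ≺? π = (π′ ≼? π) ×-dec ¬? (≡-dec Fin._≟_ π′ π)

top : ∀ k → Labels k
top zero    = []
top (suc k) = replicate (suc k) Fin.zero

allVecs : ∀ {a} {A : Set a} → List A → (n : ℕ) → List (Vec A n)
allVecs xs zero    = [] ∷ []
allVecs xs (suc n) = concatMap (λ x → map (x ∷_) (allVecs xs n)) xs

Π : ∀ k → List (Labels k)
Π k = filter isSetPartition? (allVecs (allFin k) k)

-- blocks of π are indexed by their least elements b, i.e. π[b] ≡ b
IsBlock : ∀ {k} → Labels k → Fin k → Set
IsBlock π b = lookup π b ≡ b

isBlock? : ∀ {k} (π : Labels k) → Decidable (IsBlock π)
isBlock? π b = lookup π b Fin.≟ b

numBlocks : ∀ {k} → Labels k → ℕ
numBlocks {k} π = length (filter (isBlock? π) (allFin k))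

-- The recursion is run with fuel; every recursive call replaces y by
-- some z < y, and strict chains in Π_k have length ≤ k-1, so fuel k
-- is never exhausted on a reachable call.

sumℤ : List ℤ → ℤ
sumℤ = foldr ℤ._+_ (+ 0)

μ-fuel : ∀ {k} → ℕ → Labels k → Labels k → ℤ
μ-fuel {k} fuel x y with ≡-dec Fin._≟_ x y | x ≼? y | fuel
... | yes _ | _     | _      = + 1
... | no _  | no _  | _      = + 0
... | no _  | yes _ | zero   = + 0
... | no _  | yes _ | suc f  =
  ℤ.- sumℤ (map (μ-fuel f x) (filter (λ z → (x ≼? z) ×-dec (z ≺? y)) (Π k)))

μ : ∀ {k} → Labels k → Labels k → ℤ
μ {k} = μ-fuel k

module OverField {c ℓ} (F : Field c ℓ) where
  open Field F public

  ℕ→F : ℕ → Carrier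
  ℕ→F zero    = 0#
  ℕ→F (suc n) = 1# + ℕ→F n

  ℤ→F : ℤ → Carrier
  ℤ→F (+ n)      = ℕ→F n
  ℤ→F -[1+ n ]   = - ℕ→F (suc n)

  sumF : List Carrier → Carrier
  sumF = foldr _+_ 0#

  prodF : List Carrier → Carrier
  prodF = foldr _*_ 1#

  -- tuples in A^k with A = Fin n (a finite set with |A| = n)
  Tuple : ℕ → ℕ → Set
  Tuple n k = Vec (Fin n) k

  δ : ∀ {n k} → Labels k → Tuple n k → Carrier
  δ {n} {k} τ x =
    if does (all? λ i → all? λ j →
               (lookup τ i Fin.≟ lookup τ j) →-dec (lookup x i Fin.≟ lookup x j))
    then 1# else 0#

  HasPartition : ∀ {n k} → Tuple n k → Labels k → Set
  HasPartition {n} {k} x π = ∀ (i j : Fin k) →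
    (lookup x i ≡ lookup x j → SameBlock π i j) × (SameBlock π i j → lookup x i ≡ lookup x j)

  ΣΠ : ∀ k {q} {Q : Labels k → Set q} → Decidable Q → (Labels k → Carrier) → Carrier
  ΣΠ k Q? g = sumF (map g (filter Q? (Π k)))

  -- partition indicator I_f, for f defined on Π_k ∖ {1̂}
  -- (f is given on all label vectors; only its values on Π_k ∖ {1̂} are used)
  I : ∀ {n k} → (Labels k → Carrier) → Tuple n k → Carrier
  I {n} {k} f x =
    ΣΠ k (_≺? top k) λ τ →
      ΣΠ k (_≼? τ) (λ π → f π * ℤ→F (μ π τ)) * δ τ x

  DependsOnlyOnBlock : ∀ {n k} → Labels k → Fin k → (Tuple n k → Carrier) → Set ℓ
  DependsOnlyOnBlock {n} {k} σ b g = ∀ (x y : Tuple n k) →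
    (∀ i → lookup σ i ≡ b → lookup x i ≡ lookup y i) → g x ≈ g y

  PartitionRankOne : ∀ {n k} → (Tuple n k → Carrier) → Set (c ⊔ ℓ)
  PartitionRankOne {n} {k} T =
    Σ (Labels k) λ σ → IsSetPartition σ × (2 ≤ numBlocks σ) ×
    Σ (Fin k → Tuple n k → Carrier) λ Ts →
      (∀ b → IsBlock σ b → DependsOnlyOnBlock σ b (Ts b)) ×
      (∀ x → T x ≈ prodF (map (λ b → Ts b x) (filter (isBlock? σ) (allFin k))))

  PartitionRankAtMost : ∀ {n k} → (Tuple n k → Carrier) → ℕ → Set (c ⊔ ℓ)
  PartitionRankAtMost {n} {k} T r =
    Σ (List (Tuple n k → Carrier)) λ Rs →
      (length Rs ≡ r) × All PartitionRankOne Rs ×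
      (∀ x → T x ≈ sumF (map (λ R → R x) Rs))

  -- m ≤ partition-rank(T)  (partition rank = least such r)
  _≤PartitionRank_ : ∀ {n k} → ℕ → (Tuple n k → Carrier) → Set (c ⊔ ℓ)
  m ≤PartitionRank T = ∀ r → PartitionRankAtMost T r → m ≤ r

{-# OPTIONS --safe #-}
module Submission where

-- For a tuple x whose partition σ is not 1̂ one has δ_τ(x) = [τ ≤ σ], so Möbius inversion on
-- [0̂, σ] gives I_f(x) = f(σ); by (3) this vanishes unless x fails P, and then T(x) = 0.  On the
-- diagonal, I_f(a,…,a) = −Σ_{π<1̂} f(π)μ(π,1̂) ≠ 0 and T = 1.  So I_f·T is a diagonal tensor with
-- |A| nonzero diagonal entries.  A function of partition rank one is a product of two functions
-- of complementary nonempty sets of variables, and Tao's slice-rank argument shows that a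
-- diagonal tensor with m nonzero diagonal entries is not a sum of fewer than m such products.
-- Equality in F is undecidable, so the linear algebra runs in the double-negation monad, which
-- is left at the end because ≤ on ℕ is decidable.

open import Defs
open import Level using (Level; _⊔_)
open import Data.Bool as Bool using (Bool; true; false; if_then_else_; not)
open import Data.Fin as Fin using (Fin; zero; suc)
import Data.Fin.Properties as Fin
open import Data.Fin.Subset using (Subset; inside; outside; ∣_∣; _-_)
  renaming (_∈_ to _∈ₛ_; _∉_ to _∉ₛ_; ⊤ to ⊤ₛ)
import Data.Fin.Subset.Properties as Subset
open import Data.Integer as ℤ using (+_; -[1+_])
import Data.Integer.Properties as ℤ
open import Data.List as List using (List; []; _∷_; map; length; filter; allFin; concatMap)
import Data.List.Properties as List
open import Data.List.Membership.Propositional using (_∈_)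
import Data.List.Membership.Propositional.Properties as Membership
open import Data.List.Relation.Unary.All as All using (All; []; _∷_)
import Data.List.Relation.Unary.All.Properties as All
open import Data.List.Relation.Unary.Any as Any using (Any; here; there)
open import Data.List.Relation.Unary.Unique.Propositional using (Unique)
open import Data.List.Relation.Unary.AllPairs using ([]; _∷_)
import Data.List.Relation.Unary.Unique.Propositional.Properties as Unique
open import Data.Nat as ℕ using (ℕ; zero; suc; _≤_; _<_; z≤n; s≤s)
import Data.Nat.Properties as ℕ
open import Data.Product using (Σ; ∃; _×_; _,_; proj₁; proj₂)
open import Data.Vec as Vec using (Vec; []; _∷_; lookup; replicate; tabulate)
import Data.Vec.Properties as Vec
open import Function using (_∘_; _⇔_; mk⇔; Equivalence; case_of_)
open import Relation.Binary.Definitions using (DecidableEquality)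
open import Relation.Binary.PropositionalEquality as ≡
  using (_≡_; _≢_; cong; subst; subst₂)
open import Relation.Nullary using (¬_; Dec; yes; no)
open import Relation.Nullary.Decidable
  using (does; dec-true; dec-false; ¬?; _×-dec_; _→-dec_; decidable-stable; ¬¬-excluded-middle)
open import Relation.Nullary.Negation using (DoubleNegation; contradiction; ¬¬-map)

private
  variable
    a q : Level
    A B : Set a

return : A → DoubleNegation A
return x ¬x = ¬x x

infixl 1 _>>=_

-- ¬¬-Monad of Relation.Nullary.Negation is monomorphic in the level, but
-- the binds below cross levels.
_>>=_ : DoubleNegation A → (A → DoubleNegation B) → DoubleNegation B
(¬¬x >>= f) ¬y = ¬¬x λ x → f x ¬y

¬¬-∀-Fin : ∀ {n} {Q : Fin n → Set q} → (∀ i → DoubleNegation (Q i)) → DoubleNegation (∀ i → Q i)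
¬¬-∀-Fin {n = zero}      h = return λ ()
¬¬-∀-Fin {n = suc n} {Q} h =
  h zero >>= λ q₀ → ¬¬-∀-Fin {Q = Q ∘ suc} (h ∘ suc) >>= λ q₊ →
  return λ { zero → q₀ ; (suc i) → q₊ i }

¬¬-∀-Vec : ∀ {n k} {Q : Vec (Fin n) k → Set q} →
           (∀ x → DoubleNegation (Q x)) → DoubleNegation (∀ x → Q x)
¬¬-∀-Vec {k = zero}      h = h [] >>= λ q₀ → return λ { [] → q₀ }
¬¬-∀-Vec {k = suc k} {Q} h =
  ¬¬-∀-Fin (λ a → ¬¬-∀-Vec {Q = Q ∘ (a ∷_)} (h ∘ (a ∷_))) >>= λ q →
  return λ { (a ∷ x) → q a x }

x∉p-x : ∀ {n} (p : Subset n) (x : Fin n) → x ∉ₛ p - x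
x∉p-x (s ∷ p) zero    ()
x∉p-x (s ∷ p) (suc x) (Vec.there x∈p-x) = x∉p-x p x x∈p-x

∣p∣≤1+∣p-x∣ : ∀ {n} (p : Subset n) (x : Fin n) → ∣ p ∣ ≤ suc ∣ p - x ∣
∣p∣≤1+∣p-x∣ (inside  ∷ p) zero    = ℕ.≤-reflexive (cong (suc ∘ ∣_∣) (≡.sym (Subset.p─⊥≡p p)))
∣p∣≤1+∣p-x∣ (outside ∷ p) zero    =
  subst (λ q → ∣ p ∣ ≤ suc ∣ q ∣) (≡.sym (Subset.p─⊥≡p p)) (ℕ.n≤1+n _)
∣p∣≤1+∣p-x∣ (inside  ∷ p) (suc x) = s≤s (∣p∣≤1+∣p-x∣ p x)
∣p∣≤1+∣p-x∣ (outside ∷ p) (suc x) = ∣p∣≤1+∣p-x∣ p x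

lookup-ext : ∀ {k} {x y : Vec A k} → (∀ i → lookup x i ≡ lookup y i) → x ≡ y
lookup-ext {x = x} {y} h = begin
  x                ≡⟨ Vec.tabulate∘lookup x ⟨
  tabulate (lookup x) ≡⟨ Vec.tabulate-cong h ⟩
  tabulate (lookup y) ≡⟨ Vec.tabulate∘lookup y ⟩
  y                ∎
  where open ≡.≡-Reasoning

lookup-≢ : ∀ {k m} {x y : Vec (Fin m) k} → x ≢ y → ∃ λ i → lookup x i ≢ lookup y i
lookup-≢ {x = x} {y} x≢y with Fin.any? (λ i → ¬? (lookup x i Fin.≟ lookup y i))
... | yes witness = witness
... | no  none    = contradiction (lookup-ext λ i →
  decidable-stable (lookup x i Fin.≟ lookup y i) (λ xᵢ≢yᵢ → none (i , xᵢ≢yᵢ))) x≢y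

module _ {p : Level} {P Q : A → Set p} (P? : ∀ x → Dec (P x)) (Q? : ∀ x → Dec (Q x))
         (P⇒Q : ∀ {x} → P x → Q x) where

  length-filter-mono : ∀ xs → length (filter P? xs) ≤ length (filter Q? xs)
  length-filter-mono []       = z≤n
  length-filter-mono (x ∷ xs) with P? x | Q? x
  ... | yes _  | yes _  = s≤s (length-filter-mono xs)
  ... | yes px | no ¬qx = contradiction (P⇒Q px) ¬qx
  ... | no _   | yes _  = ℕ.m≤n⇒m≤1+n (length-filter-mono xs)
  ... | no _   | no _   = length-filter-mono xs

  length-filter-mono-< : ∀ {y} xs → y ∈ xs → Q y → ¬ P y → length (filter P? xs) < length (filter Q? xs)
  length-filter-mono-< (x ∷ xs) (here ≡.refl) qy ¬py with P? x | Q? x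
  ... | yes px | _      = contradiction px ¬py
  ... | no _   | yes _  = s≤s (length-filter-mono xs)
  ... | no _   | no ¬qy = contradiction qy ¬qy
  length-filter-mono-< (x ∷ xs) (there y∈xs) qy ¬py with P? x | Q? x
  ... | yes _  | yes _  = s≤s (length-filter-mono-< xs y∈xs qy ¬py)
  ... | yes px | no ¬qx = contradiction (P⇒Q px) ¬qx
  ... | no _   | yes _  = ℕ.m≤n⇒m≤1+n (length-filter-mono-< xs y∈xs qy ¬py)
  ... | no _   | no _   = length-filter-mono-< xs y∈xs qy ¬py

firstIndex : ∀ {n k} → Vec (Fin n) k → Fin k → Fin k
firstIndex (a ∷ x) zero    = zero
firstIndex (a ∷ x) (suc i) = if does (lookup x i Fin.≟ a) then zero else suc (firstIndex x i)

partitionOf : ∀ {n k} → Vec (Fin n) k → Labels k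
partitionOf x = tabulate (firstIndex x)

module _ {n : ℕ} where

  firstIndex-≡ : ∀ {k} a (x : Vec (Fin n) k) i → lookup x i ≡ a → firstIndex (a ∷ x) (suc i) ≡ zero
  firstIndex-≡ a x i xᵢ≡a with lookup x i Fin.≟ a
  ... | yes _     = ≡.refl
  ... | no  xᵢ≢a = contradiction xᵢ≡a xᵢ≢a

  lookup-firstIndex : ∀ {k} (x : Vec (Fin n) k) i → lookup x (firstIndex x i) ≡ lookup x i
  lookup-firstIndex (a ∷ x) zero    = ≡.refl
  lookup-firstIndex (a ∷ x) (suc i) with lookup x i Fin.≟ a
  ... | yes xᵢ≡a = ≡.sym xᵢ≡a
  ... | no  _    = lookup-firstIndex x i

  firstIndex-≤ : ∀ {k} (x : Vec (Fin n) k) i → firstIndex x i Fin.≤ i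
  firstIndex-≤ (a ∷ x) zero    = z≤n
  firstIndex-≤ (a ∷ x) (suc i) with lookup x i Fin.≟ a
  ... | yes _ = z≤n
  ... | no  _ = s≤s (firstIndex-≤ x i)

  firstIndex-cong : ∀ {k} (x : Vec (Fin n) k) i j → lookup x i ≡ lookup x j → firstIndex x i ≡ firstIndex x j
  firstIndex-cong (a ∷ x) zero    zero    _  = ≡.refl
  firstIndex-cong (a ∷ x) zero    (suc j) eq = ≡.sym (firstIndex-≡ a x j (≡.sym eq))
  firstIndex-cong (a ∷ x) (suc i) zero    eq = firstIndex-≡ a x i eq
  firstIndex-cong (a ∷ x) (suc i) (suc j) eq with lookup x i Fin.≟ a | lookup x j Fin.≟ a
  ... | yes _    | yes _    = ≡.refl
  ... | yes xᵢ≡a | no  xⱼ≢a = contradiction (≡.trans (≡.sym eq) xᵢ≡a) xⱼ≢a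
  ... | no  xᵢ≢a | yes xⱼ≡a = contradiction (≡.trans eq xⱼ≡a) xᵢ≢a
  ... | no  _    | no  _    = cong suc (firstIndex-cong x i j eq)

  sameBlock-partitionOf : ∀ {k} (x : Vec (Fin n) k) i j →
                          SameBlock (partitionOf x) i j ⇔ (lookup x i ≡ lookup x j)
  sameBlock-partitionOf x i j = mk⇔
    (λ eq → begin
      lookup x i                ≡⟨ lookup-firstIndex x i ⟨
      lookup x (firstIndex x i) ≡⟨ cong (lookup x) (≡.trans (≡.sym (lookup-partitionOf i)) eq) ⟩
      lookup x (lookup (partitionOf x) j) ≡⟨ cong (lookup x) (lookup-partitionOf j) ⟩
      lookup x (firstIndex x j) ≡⟨ lookup-firstIndex x j ⟩
      lookup x j                ∎)
    (λ eq → begin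
      lookup (partitionOf x) i ≡⟨ lookup-partitionOf i ⟩
      firstIndex x i           ≡⟨ firstIndex-cong x i j eq ⟩
      firstIndex x j           ≡⟨ lookup-partitionOf j ⟨
      lookup (partitionOf x) j ∎)
    where
    open ≡.≡-Reasoning
    lookup-partitionOf : ∀ l → lookup (partitionOf x) l ≡ firstIndex x l
    lookup-partitionOf = Vec.lookup∘tabulate (firstIndex x)

  partitionOf-isSetPartition : ∀ {k} (x : Vec (Fin n) k) → IsSetPartition (partitionOf x)
  partitionOf-isSetPartition x i =
    subst (Fin._≤ i) (≡.sym (lookup-partitionOf i)) (firstIndex-≤ x i) ,
    Equivalence.from (sameBlock-partitionOf x _ i)
      (≡.trans (cong (lookup x) (lookup-partitionOf i)) (lookup-firstIndex x i))
    where lookup-partitionOf = Vec.lookup∘tabulate (firstIndex x)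

module _ {k : ℕ} where

  ≼-antisym : {π σ : Labels k} → IsSetPartition π → IsSetPartition σ → π ≼ σ → σ ≼ π → π ≡ σ
  ≼-antisym {π} {σ} π-part σ-part π≼σ σ≼π = lookup-ext λ i → Fin.≤-antisym
    (subst (Fin._≤ lookup σ i) (σ≼π _ i (proj₂ (σ-part i))) (proj₁ (π-part (lookup σ i))))
    (subst (Fin._≤ lookup π i) (π≼σ _ i (proj₂ (π-part i))) (proj₁ (σ-part (lookup π i))))

  isBlock-≼ : {π σ : Labels k} → IsSetPartition π → IsSetPartition σ → π ≼ σ →
              ∀ {b} → IsBlock σ b → IsBlock π b
  isBlock-≼ {π} {σ} π-part σ-part π≼σ {b} σb≡b = Fin.≤-antisym (proj₁ (π-part b))
    (subst (Fin._≤ lookup π b) (≡.trans (π≼σ _ b (proj₂ (π-part b))) σb≡b) (proj₁ (σ-part (lookup π b))))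

  numBlocks-≺ : {π σ : Labels k} → IsSetPartition π → IsSetPartition σ → π ≼ σ → π ≢ σ →
                numBlocks σ < numBlocks π
  numBlocks-≺ {π} {σ} π-part σ-part π≼σ π≢σ with lookup-≢ π≢σ
  ... | i , πᵢ≢σᵢ = length-filter-mono-< (isBlock? σ) (isBlock? π) (isBlock-≼ {π} {σ} π-part σ-part π≼σ)
    (allFin k) (Membership.∈-allFin (lookup π i)) (proj₂ (π-part i))
    (λ σb≡b → πᵢ≢σᵢ (≡.sym (≡.trans (≡.sym (π≼σ _ i (proj₂ (π-part i)))) σb≡b)))

  numBlocks-≤ : (π : Labels k) → numBlocks π ≤ k
  numBlocks-≤ π = subst (numBlocks π ≤_) (List.length-tabulate {n = k} (λ i → i))
    (List.length-filter (isBlock? π) (allFin k))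

module _ {k : ℕ} where

  top-isSetPartition : IsSetPartition (top (suc k))
  top-isSetPartition i =
    subst (Fin._≤ i) (≡.sym (Vec.lookup-replicate i zero)) z≤n ,
    ≡.trans (Vec.lookup-replicate (lookup (top (suc k)) i) zero) (≡.sym (Vec.lookup-replicate i zero))

  sameBlock-top : ∀ i j → SameBlock (top (suc k)) i j
  sameBlock-top i j = ≡.trans (Vec.lookup-replicate i zero) (≡.sym (Vec.lookup-replicate j zero))

  ≼-top : (π : Labels (suc k)) → π ≼ top (suc k)
  ≼-top π i j _ = sameBlock-top i j

  partitionOf≡top⇒constant : ∀ {n} (x : Vec (Fin n) (suc k)) → partitionOf x ≡ top (suc k) →
                             x ≡ replicate (suc k) (lookup x zero)
  partitionOf≡top⇒constant x π≡1̂ = lookup-ext λ i → ≡.trans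
    (Equivalence.to (sameBlock-partitionOf x i zero)
      (subst (λ π → SameBlock π i zero) (≡.sym π≡1̂) (sameBlock-top i zero)))
    (≡.sym (Vec.lookup-replicate i (lookup x zero)))

allVecs-complete : ∀ (xs : List A) {m} (v : Vec A m) → (∀ i → lookup v i ∈ xs) → v ∈ allVecs xs m
allVecs-complete xs []      h = here ≡.refl
allVecs-complete xs (a ∷ v) h = Membership.∈-concatMap⁺ _
  (Any.map (λ { ≡.refl → Membership.∈-map⁺ (a ∷_) (allVecs-complete xs v (h ∘ suc)) }) (h zero))

allVecs-unique : ∀ {xs : List A} → Unique xs → ∀ m → Unique (allVecs xs m)
allVecs-unique         xs! zero    = [] ∷ []
allVecs-unique {A = A} xs! (suc m) = go xs!
  where
  V = allVecs _ m
  extend : A → List (Vec A (suc m))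
  extend y = map (y ∷_) V
  head∉ : ∀ {y w} {ys} → All (y ≢_) ys → ¬ Any (λ x → (y ∷ w) ∈ extend x) ys
  head∉ (y≢x ∷ _) (here yw∈) with Membership.∈-map⁻ _ yw∈
  ... | _ , _ , eq = y≢x (Vec.∷-injectiveˡ eq)
  head∉ (_ ∷ y∉) (there yw∈) = head∉ y∉ yw∈
  go : ∀ {ys} → Unique ys → Unique (concatMap extend ys)
  go []           = []
  go (y∉ ∷ ys!) = Unique.++⁺ (Unique.map⁺ Vec.∷-injectiveʳ (allVecs-unique xs! m)) (go ys!)
    λ (v∈y , v∈ys) → case Membership.∈-map⁻ _ v∈y of λ where
      (_ , _ , ≡.refl) → head∉ y∉ (Membership.∈-concatMap⁻ extend v∈ys)

module _ {k : ℕ} where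

  Π-complete : {π : Labels k} → IsSetPartition π → π ∈ Π k
  Π-complete {π} π-part = Membership.∈-filter⁺ isSetPartition?
    (allVecs-complete (allFin k) π (λ i → Membership.∈-allFin _)) π-part

  Π-sound : All IsSetPartition (Π k)
  Π-sound = All.all-filter isSetPartition? (allVecs (allFin k) k)

  Π-unique : Unique (Π k)
  Π-unique = Unique.filter⁺ isSetPartition? (allVecs-unique (Unique.allFin⁺ k) k)

_≟_ : ∀ {k} → DecidableEquality (Labels k)
_≟_ = Vec.≡-dec Fin._≟_

between? : ∀ {k} (π σ τ : Labels k) → Dec ((π ≼ τ) × (τ ≺ σ))
between? π σ τ = (π ≼? τ) ×-dec (τ ≺? σ)

module _ {k : ℕ} where

  filter-between-sound : ∀ (π σ : Labels k) →
                         All (λ τ → IsSetPartition τ × (π ≼ τ) × (τ ≺ σ)) (filter (between? π σ) (Π k))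
  filter-between-sound π σ = All.zip (All.filter⁺ (between? π σ) Π-sound , All.all-filter (between? π σ) (Π k))

  μ-fuel-refl : ∀ fuel {π σ : Labels k} → π ≡ σ → μ-fuel fuel π σ ≡ + 1
  μ-fuel-refl fuel {π} ≡.refl with Vec.≡-dec Fin._≟_ π π
  ... | yes _   = ≡.refl
  ... | no  π≢π = contradiction ≡.refl π≢π

  μ-fuel-≰ : ∀ fuel {π σ : Labels k} → ¬ π ≼ σ → μ-fuel fuel π σ ≡ + 0
  μ-fuel-≰ fuel {π} {σ} π⋠σ with Vec.≡-dec Fin._≟_ π σ | π ≼? σ
  ... | yes ≡.refl | _       = contradiction (λ _ _ eq → eq) π⋠σ
  ... | no  _    | yes π≼σ = contradiction π≼σ π⋠σ
  ... | no  _    | no  _   = ≡.refl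

  μ-fuel-suc : ∀ fuel {π σ : Labels k} → π ≢ σ → π ≼ σ →
               μ-fuel (suc fuel) π σ ≡ ℤ.- sumℤ (map (μ-fuel fuel π) (filter (between? π σ) (Π k)))
  μ-fuel-suc fuel {π} {σ} π≢σ π≼σ with Vec.≡-dec Fin._≟_ π σ | π ≼? σ
  ... | yes π≡σ | _       = contradiction π≡σ π≢σ
  ... | no  _   | no  π⋠σ = contradiction π≼σ π⋠σ
  ... | no  _   | yes _   = ≡.refl

  -- Every recursive call moves to a partition with more blocks, so fuel exceeding the
  -- difference in the numbers of blocks is never exhausted.
  Enough : ℕ → Labels k → Labels k → Set
  Enough fuel π σ = numBlocks π ≤ numBlocks σ ℕ.+ fuel

  no-fuel : ∀ {π σ : Labels k} → IsSetPartition π → IsSetPartition σ → π ≢ σ → π ≼ σ → ¬ Enough 0 π σ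
  no-fuel {π} π-part σ-part π≢σ π≼σ enough =
    ℕ.<⇒≱ (numBlocks-≺ π-part σ-part π≼σ π≢σ) (subst (numBlocks π ≤_) (ℕ.+-identityʳ _) enough)

  μ-fuel-stable : ∀ m m' {π σ : Labels k} → IsSetPartition π → IsSetPartition σ →
                  Enough m π σ → Enough m' π σ → μ-fuel m π σ ≡ μ-fuel m' π σ
  μ-fuel-stable-≺ : ∀ m m' {π σ : Labels k} → IsSetPartition π → IsSetPartition σ → π ≢ σ → π ≼ σ →
                    Enough m π σ → Enough m' π σ → μ-fuel m π σ ≡ μ-fuel m' π σ

  μ-fuel-stable m m' {π} {σ} π-part σ-part = by-cases (π ≟ σ) (π ≼? σ)
    where
    by-cases : Dec (π ≡ σ) → Dec (π ≼ σ) → Enough m π σ → Enough m' π σ → μ-fuel m π σ ≡ μ-fuel m' π σ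
    by-cases (yes π≡σ) _         _ _ = ≡.trans (μ-fuel-refl m {π} {σ} π≡σ) (≡.sym (μ-fuel-refl m' {π} {σ} π≡σ))
    by-cases (no _)    (no π⋠σ)  _ _ = ≡.trans (μ-fuel-≰ m {π} {σ} π⋠σ) (≡.sym (μ-fuel-≰ m' {π} {σ} π⋠σ))
    by-cases (no π≢σ)  (yes π≼σ)     = μ-fuel-stable-≺ m m' π-part σ-part π≢σ π≼σ

  μ-fuel-stable-≺ zero _ π-part σ-part π≢σ π≼σ enough _ =
    contradiction enough (no-fuel π-part σ-part π≢σ π≼σ)
  μ-fuel-stable-≺ (suc f) zero π-part σ-part π≢σ π≼σ _ enough' =
    contradiction enough' (no-fuel π-part σ-part π≢σ π≼σ)
  μ-fuel-stable-≺ (suc f) (suc f') {π} {σ} π-part σ-part π≢σ π≼σ enough enough' = begin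
    μ-fuel (suc f) π σ                                         ≡⟨ μ-fuel-suc f {π} {σ} π≢σ π≼σ ⟩
    ℤ.- sumℤ (map (μ-fuel f π) (filter (between? π σ) (Π k)))   ≡⟨ cong (λ zs → ℤ.- sumℤ zs) (List.map-cong-local
      (All.map (λ {τ} (τ-part , τ-between) → μ-fuel-stable f f' {π} {τ} π-part τ-part
                 (enough-below enough τ-part τ-between) (enough-below enough' τ-part τ-between))
               (filter-between-sound π σ))) ⟩
    ℤ.- sumℤ (map (μ-fuel f' π) (filter (between? π σ) (Π k))) ≡⟨ μ-fuel-suc f' {π} {σ} π≢σ π≼σ ⟨
    μ-fuel (suc f') π σ                                        ∎
    where
    open ≡.≡-Reasoning
    enough-below : ∀ {g τ} → Enough (suc g) π σ → IsSetPartition τ → (π ≼ τ) × (τ ≺ σ) → Enough g π τ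
    enough-below {g} {τ} enough τ-part (_ , τ≼σ , τ≢σ) = ℕ.≤-trans enough
      (subst (_≤ numBlocks τ ℕ.+ g) (≡.sym (ℕ.+-suc _ g)) (ℕ.+-monoˡ-≤ g (numBlocks-≺ τ-part σ-part τ≼σ τ≢σ)))

module _ {k : ℕ} where

  μ-recursion : {π σ : Labels (suc k)} → IsSetPartition π → IsSetPartition σ → π ≢ σ → π ≼ σ →
                μ π σ ≡ ℤ.- sumℤ (map (μ π) (filter (between? π σ) (Π (suc k))))
  μ-recursion {π} {σ} π-part σ-part π≢σ π≼σ = ≡.trans (μ-fuel-suc k {π} {σ} π≢σ π≼σ)
    (cong (λ zs → ℤ.- sumℤ zs) (List.map-cong-local (All.map (λ {τ} (τ-part , _ , τ≼σ , τ≢σ) →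
      let enough = fuel-k-suffices {τ} (numBlocks-≺ τ-part σ-part τ≼σ τ≢σ) in
      μ-fuel-stable k (suc k) {π} {τ} π-part τ-part enough (ℕ.≤-trans enough (ℕ.+-monoʳ-≤ _ (ℕ.n≤1+n k))))
      (filter-between-sound π σ))))
    where
    fuel-k-suffices : ∀ {τ} → numBlocks σ < numBlocks τ → Enough k π τ
    fuel-k-suffices σ<τ = ℕ.≤-trans (numBlocks-≤ π) (ℕ.+-monoˡ-≤ k (ℕ.≤-trans (s≤s z≤n) σ<τ))

module Sums {c ℓ} (F : Field c ℓ) where

  open OverField F hiding (zero; _-_)
  open import Algebra.Properties.Ring ring using (-0#≈0#; -‿+-comm)
  open import Algebra.Properties.CommutativeSemigroup +-commutativeSemigroup using ()
    renaming (interchange to +-interchange)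
  open import Algebra.Properties.Semiring.Sum semiring public
    using (sum; sum-syntax; sum-cong-≋; sum-replicate-zero; ∑-distrib-+; *-distribˡ-sum; *-distribʳ-sum)
  open import Relation.Binary.Reasoning.Setoid setoid

  x≉0∧y≉0⇒x*y≉0 : ∀ {x y} → ¬ x ≈ 0# → ¬ y ≈ 0# → ¬ x * y ≈ 0#
  x≉0∧y≉0⇒x*y≉0 {x} {y} x≉0 y≉0 xy≈0 with inverse x x≉0
  ... | x⁻¹ , xx⁻¹≈1 = y≉0 (begin
    y               ≈⟨ *-identityˡ y ⟨
    1# * y          ≈⟨ *-congʳ (trans (sym xx⁻¹≈1) (*-comm x x⁻¹)) ⟩
    (x⁻¹ * x) * y   ≈⟨ *-assoc x⁻¹ x y ⟩
    x⁻¹ * (x * y)   ≈⟨ *-congˡ xy≈0 ⟩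
    x⁻¹ * 0#        ≈⟨ zeroʳ x⁻¹ ⟩
    0#              ∎)

  sum-zero : ∀ {n} {g : Fin n → Carrier} → (∀ i → g i ≈ 0#) → sum g ≈ 0#
  sum-zero {n} g≈0 = trans (sum-cong-≋ g≈0) (sum-replicate-zero n)

  sum-neg : ∀ {n} (g : Fin n → Carrier) → ∑[ i < n ] (- g i) ≈ - sum g
  sum-neg {zero}  g = sym -0#≈0#
  sum-neg {suc n} g = trans (+-congˡ (sum-neg (g ∘ suc))) (-‿+-comm _ _)

  sum-single : ∀ {n} (g : Fin n → Carrier) b → (∀ i → i ≢ b → g i ≈ 0#) → sum g ≈ g b
  sum-single {suc n} g zero    g≈0 = trans (+-congˡ (sum-zero λ i → g≈0 (suc i) λ ())) (+-identityʳ _)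
  sum-single {suc n} g (suc b) g≈0 = trans
    (+-cong (g≈0 zero λ ()) (sum-single (g ∘ suc) b λ i i≢b → g≈0 (suc i) (i≢b ∘ Fin.suc-injective)))
    (+-identityˡ _)

  sumF-cong : ∀ {g h : A → Carrier} {xs} → All (λ x → g x ≈ h x) xs → sumF (map g xs) ≈ sumF (map h xs)
  sumF-cong []       = refl
  sumF-cong (e ∷ es) = +-cong e (sumF-cong es)

  sumF-zero : ∀ {g : A → Carrier} {xs} → All (λ x → g x ≈ 0#) xs → sumF (map g xs) ≈ 0#
  sumF-zero []       = refl
  sumF-zero (e ∷ es) = trans (+-cong e (sumF-zero es)) (+-identityˡ 0#)

  sumF-+ : ∀ (g h : A → Carrier) xs → sumF (map (λ x → g x + h x) xs) ≈ sumF (map g xs) + sumF (map h xs)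
  sumF-+ g h []       = sym (+-identityˡ 0#)
  sumF-+ g h (x ∷ xs) = trans (+-congˡ (sumF-+ g h xs)) (+-interchange (g x) (h x) _ _)

  sumF-neg : ∀ (g : A → Carrier) xs → sumF (map (λ x → - g x) xs) ≈ - sumF (map g xs)
  sumF-neg g []       = sym -0#≈0#
  sumF-neg g (x ∷ xs) = trans (+-congˡ (sumF-neg g xs)) (-‿+-comm _ _)

  *-distribˡ-sumF : ∀ u (g : A → Carrier) xs → u * sumF (map g xs) ≈ sumF (map (λ x → u * g x) xs)
  *-distribˡ-sumF u g []       = zeroʳ u
  *-distribˡ-sumF u g (x ∷ xs) = trans (distribˡ u _ _) (+-congˡ (*-distribˡ-sumF u g xs))

  sumF-comm : ∀ (G : A → B → Carrier) xs ys →
              sumF (map (λ x → sumF (map (G x) ys)) xs) ≈ sumF (map (λ y → sumF (map (λ x → G x y) xs)) ys)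
  sumF-comm G []       ys = sym (sumF-zero (All.universal (λ _ → refl) ys))
  sumF-comm G (x ∷ xs) ys = trans (+-congˡ (sumF-comm G xs ys)) (sym (sumF-+ (G x) _ ys))

  sum-sumF : ∀ {n} (G : A → Fin n → Carrier) xs →
             ∑[ i < n ] (sumF (map (λ x → G x i) xs)) ≈ sumF (map (λ x → sum (G x)) xs)
  sum-sumF {n = n} G [] = sum-zero {n} λ _ → refl
  sum-sumF G (x ∷ xs) = trans (∑-distrib-+ (G x) _) (+-congˡ (sum-sumF G xs))

  prodF-cong : ∀ {g h : A → Carrier} {xs} → All (λ x → g x ≈ h x) xs → prodF (map g xs) ≈ prodF (map h xs)
  prodF-cong []       = refl
  prodF-cong (e ∷ es) = *-cong e (prodF-cong es)

  ind : ∀ {p} {P : Set p} → Dec P → Carrier → Carrier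
  ind P? u = if does P? then u else 0#

  module _ {p : Level} {P : Set p} where

    ind-yes : ∀ (P? : Dec P) {u} → P → ind P? u ≈ u
    ind-yes (yes _) p = refl
    ind-yes (no ¬p) p = contradiction p ¬p

    ind-no : ∀ (P? : Dec P) {u} → ¬ P → ind P? u ≈ 0#
    ind-no (yes p) ¬p = contradiction p ¬p
    ind-no (no  _) ¬p = refl

    ind-cong : ∀ (P? : Dec P) {u v} → u ≈ v → ind P? u ≈ ind P? v
    ind-cong (yes _) u≈v = u≈v
    ind-cong (no  _) u≈v = refl

    ind-zero : ∀ (P? : Dec P) → ind P? 0# ≈ 0#
    ind-zero (yes _) = refl
    ind-zero (no  _) = refl

    ind-*ˡ : ∀ (P? : Dec P) u v → ind P? (u * v) ≈ u * ind P? v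
    ind-*ˡ (yes _) u v = refl
    ind-*ˡ (no  _) u v = sym (zeroʳ u)

    *-ind-1 : ∀ (P? : Dec P) u → u * ind P? 1# ≈ ind P? u
    *-ind-1 (yes _) u = *-identityʳ u
    *-ind-1 (no  _) u = zeroʳ u

    ind-sumF : ∀ (P? : Dec P) (g : A → Carrier) xs →
               ind P? (sumF (map g xs)) ≈ sumF (map (λ x → ind P? (g x)) xs)
    ind-sumF (yes _) g xs = refl
    ind-sumF (no  _) g xs = sym (sumF-zero (All.universal (λ _ → refl) xs))

    ind-⇔ : ∀ {q} {Q : Set q} (P? : Dec P) (Q? : Dec Q) {u} → P ⇔ Q → ind P? u ≈ ind Q? u
    ind-⇔ (yes _) (yes _) P⇔Q = refl
    ind-⇔ (yes p) (no ¬q) P⇔Q = contradiction (Equivalence.to P⇔Q p) ¬q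
    ind-⇔ (no ¬p) (yes q) P⇔Q = contradiction (Equivalence.from P⇔Q q) ¬p
    ind-⇔ (no  _) (no  _) P⇔Q = refl

  ind-ind : ∀ {p q} {P : Set p} {Q : Set q} (P? : Dec P) (Q? : Dec Q) u → ind P? (ind Q? u) ≈ ind (Q? ×-dec P?) u
  ind-ind (yes _) (yes _) u = refl
  ind-ind (yes _) (no  _) u = refl
  ind-ind (no  _) (yes _) u = refl
  ind-ind (no  _) (no  _) u = refl

  sumF-filter : ∀ {q} {Q : A → Set q} (Q? : ∀ x → Dec (Q x)) (g : A → Carrier) xs →
                sumF (map g (filter Q? xs)) ≈ sumF (map (λ x → ind (Q? x) (g x)) xs)
  sumF-filter Q? g []       = refl
  sumF-filter Q? g (x ∷ xs) with Q? x
  ... | yes _ = +-congˡ (sumF-filter Q? g xs)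
  ... | no  _ = trans (sumF-filter Q? g xs) (sym (+-identityˡ _))

  sumF-single : ∀ (_≟_ : DecidableEquality A) (g : A → Carrier) {xs} {y} → Unique xs → y ∈ xs →
                sumF (map (λ x → ind (x ≟ y) (g x)) xs) ≈ g y
  sumF-single _≟_ g {y ∷ _} (y∉ ∷ _) (here ≡.refl) = trans
    (+-cong (ind-yes (y ≟ y) ≡.refl) (sumF-zero (All.map (λ y≢x → ind-no (_ ≟ y) (y≢x ∘ ≡.sym)) y∉)))
    (+-identityʳ _)
  sumF-single _≟_ g {x ∷ _} (x∉ ∷ xs!) (there y∈xs) = trans
    (+-cong (ind-no (x ≟ _) (All.lookup x∉ y∈xs)) (sumF-single _≟_ g xs! y∈xs))
    (+-identityˡ _)

module Annihilators {c ℓ} (F : Field c ℓ) where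

  open OverField F hiding (zero; _-_)
  open Sums F
  open import Algebra.Properties.Ring ring using (-‿distribˡ-*; -‿distribʳ-*; x[y-z]≈xy-xz; x∙y⁻¹≈ε⇒x≈y)
  open import Algebra.Properties.CommutativeSemigroup *-commutativeSemigroup using (x∙yz≈y∙xz)
  open import Relation.Binary.Reasoning.Setoid setoid

  infix 4 _⟂_
  _⟂_ : ∀ {n} → (Fin n → Carrier) → (Fin n → Carrier) → Set ℓ
  _⟂_ {n} v φ = ∑[ a < n ] (v a * φ a) ≈ 0#

  record Annihilator {n} (φs : List (Fin n → Carrier)) (s : Subset n) : Set (c ⊔ ℓ) where
    field
      vector     : Fin n → Carrier
      support    : Subset n
      support⊆s  : ∀ {a} → a ∈ₛ support → a ∈ₛ s
      large      : ∣ s ∣ ≤ ∣ support ∣ ℕ.+ length φs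
      nonzero    : ∀ {a} → a ∈ₛ support → ¬ vector a ≈ 0#
      vanishes   : ∀ {a} → a ∉ₛ s → vector a ≈ 0#
      orthogonal : All (vector ⟂_) φs

  module _ {n : ℕ} where

    annihilator-[] : (s : Subset n) → Annihilator [] s
    annihilator-[] s = record
      { vector     = λ a → ind (a Subset.∈? s) 1#
      ; support    = s
      ; support⊆s  = λ a∈s → a∈s
      ; large      = ℕ.≤-reflexive (≡.sym (ℕ.+-identityʳ _))
      ; nonzero    = λ {a} a∈s → 1≉0 ∘ trans (sym (ind-yes (a Subset.∈? s) a∈s))
      ; vanishes   = λ {a} → ind-no (a Subset.∈? s)
      ; orthogonal = []
      }

    annihilator-∷-vanishing : ∀ {φ φs} {s : Subset n} → (∀ {a} → a ∈ₛ s → φ a ≈ 0#) →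
                              Annihilator φs s → Annihilator (φ ∷ φs) s
    annihilator-∷-vanishing {φ} {s = s} φ≈0 A = record
      { vector     = vector
      ; support    = support
      ; support⊆s  = support⊆s
      ; large      = ℕ.≤-trans large (ℕ.+-monoʳ-≤ ∣ support ∣ (ℕ.n≤1+n _))
      ; nonzero    = nonzero
      ; vanishes   = vanishes
      ; orthogonal = sum-zero (λ a → term≈0 (a Subset.∈? s)) ∷ orthogonal
      }
      where
      open Annihilator A
      term≈0 : ∀ {a} → Dec (a ∈ₛ s) → vector a * φ a ≈ 0#
      term≈0 (yes a∈s) = trans (*-congˡ (φ≈0 a∈s)) (zeroʳ _)
      term≈0 (no  a∉s) = trans (*-congʳ (vanishes a∉s)) (zeroˡ _)

    -- Gaussian elimination with pivot a₀: every ψ is replaced by ψ - (ψ a₀ / φ a₀) φ, which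
    -- vanishes at a₀; a solution on s - a₀ is then corrected at a₀ to become orthogonal to φ.
    module Pivot {φ : Fin n → Carrier} {a₀ : Fin n} (φa₀≉0 : ¬ φ a₀ ≈ 0#) where

      φa₀⁻¹ : Carrier
      φa₀⁻¹ = proj₁ (inverse (φ a₀) φa₀≉0)

      φa₀⁻¹*φa₀≈1 : φa₀⁻¹ * φ a₀ ≈ 1#
      φa₀⁻¹*φa₀≈1 = trans (*-comm φa₀⁻¹ (φ a₀)) (proj₂ (inverse (φ a₀) φa₀≉0))

      eliminate : (Fin n → Carrier) → Fin n → Carrier
      eliminate ψ a = ψ a + - ((ψ a₀ * φa₀⁻¹) * φ a)

      module Corrected (w : Fin n → Carrier) where

        X = ∑[ a < n ] (w a * φ a)
        t = - (X * φa₀⁻¹)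

        corrected : Fin n → Carrier
        corrected a = w a + ind (a Fin.≟ a₀) t

        corrected·g : ∀ (g : Fin n → Carrier) →
                      ∑[ a < n ] (corrected a * g a) ≈ ∑[ a < n ] (w a * g a) + t * g a₀
        corrected·g g = begin
          ∑[ a < n ] (corrected a * g a)
            ≈⟨ sum-cong-≋ (λ a → distribʳ (g a) (w a) _) ⟩
          ∑[ a < n ] (w a * g a + ind (a Fin.≟ a₀) t * g a)
            ≈⟨ ∑-distrib-+ (λ a → w a * g a) _ ⟩
          ∑[ a < n ] (w a * g a) + ∑[ a < n ] (ind (a Fin.≟ a₀) t * g a)
            ≈⟨ +-congˡ (sum-single _ a₀ λ a a≢a₀ → trans (*-congʳ (ind-no (a Fin.≟ a₀) a≢a₀)) (zeroˡ _)) ⟩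
          ∑[ a < n ] (w a * g a) + ind (a₀ Fin.≟ a₀) t * g a₀
            ≈⟨ +-congˡ (*-congʳ (ind-yes (a₀ Fin.≟ a₀) ≡.refl)) ⟩
          ∑[ a < n ] (w a * g a) + t * g a₀
            ∎

        t*φa₀≈-X : t * φ a₀ ≈ - X
        t*φa₀≈-X = begin
          - (X * φa₀⁻¹) * φ a₀   ≈⟨ -‿distribˡ-* (X * φa₀⁻¹) (φ a₀) ⟨
          - ((X * φa₀⁻¹) * φ a₀) ≈⟨ -‿cong (*-assoc X φa₀⁻¹ (φ a₀)) ⟩
          - (X * (φa₀⁻¹ * φ a₀)) ≈⟨ -‿cong (*-congˡ φa₀⁻¹*φa₀≈1) ⟩
          - (X * 1#)             ≈⟨ -‿cong (*-identityʳ X) ⟩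
          - X                    ∎

        corrected⟂φ : corrected ⟂ φ
        corrected⟂φ = trans (corrected·g φ) (trans (+-congˡ t*φa₀≈-X) (-‿inverseʳ X))

        module _ (ψ : Fin n → Carrier) where

          κ = ψ a₀ * φa₀⁻¹

          t*ψa₀≈-κX : t * ψ a₀ ≈ - (κ * X)
          t*ψa₀≈-κX = begin
            t * ψ a₀                    ≈⟨ *-congˡ (*-identityʳ (ψ a₀)) ⟨
            t * (ψ a₀ * 1#)             ≈⟨ *-congˡ (*-congˡ φa₀⁻¹*φa₀≈1) ⟨
            t * (ψ a₀ * (φa₀⁻¹ * φ a₀)) ≈⟨ *-congˡ (*-assoc (ψ a₀) φa₀⁻¹ (φ a₀)) ⟨
            t * (κ * φ a₀)              ≈⟨ x∙yz≈y∙xz t κ (φ a₀) ⟩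
            κ * (t * φ a₀)              ≈⟨ *-congˡ t*φa₀≈-X ⟩
            κ * - X                     ≈⟨ -‿distribʳ-* κ X ⟨
            - (κ * X)                   ∎

          w·eliminate : ∑[ a < n ] (w a * eliminate ψ a) ≈ ∑[ a < n ] (w a * ψ a) + - (κ * X)
          w·eliminate = begin
            ∑[ a < n ] (w a * eliminate ψ a)
              ≈⟨ sum-cong-≋ (λ a → x[y-z]≈xy-xz (w a) (ψ a) (κ * φ a)) ⟩
            ∑[ a < n ] (w a * ψ a + - (w a * (κ * φ a)))
              ≈⟨ sum-cong-≋ (λ a → +-congˡ (-‿cong (x∙yz≈y∙xz (w a) κ (φ a)))) ⟩
            ∑[ a < n ] (w a * ψ a + - (κ * (w a * φ a)))
              ≈⟨ ∑-distrib-+ (λ a → w a * ψ a) _ ⟩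
            ∑[ a < n ] (w a * ψ a) + ∑[ a < n ] (- (κ * (w a * φ a)))
              ≈⟨ +-congˡ (sum-neg (λ a → κ * (w a * φ a))) ⟩
            ∑[ a < n ] (w a * ψ a) + - ∑[ a < n ] (κ * (w a * φ a))
              ≈⟨ +-congˡ (-‿cong (*-distribˡ-sum κ (λ a → w a * φ a))) ⟨
            ∑[ a < n ] (w a * ψ a) + - (κ * X)
              ∎

          corrected⟂ψ : w ⟂ eliminate ψ → corrected ⟂ ψ
          corrected⟂ψ w⟂ψ′ = begin
            ∑[ a < n ] (corrected a * ψ a) ≈⟨ corrected·g ψ ⟩
            Y + t * ψ a₀                   ≈⟨ +-cong Y≈κX t*ψa₀≈-κX ⟩
            κ * X + - (κ * X)              ≈⟨ -‿inverseʳ (κ * X) ⟩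
            0#                             ∎
            where
            Y = ∑[ a < n ] (w a * ψ a)
            Y≈κX : Y ≈ κ * X
            Y≈κX = x∙y⁻¹≈ε⇒x≈y Y (κ * X) (trans (sym w·eliminate) w⟂ψ′)

      annihilator-∷-pivot : ∀ {φs} {s : Subset n} → a₀ ∈ₛ s →
                            Annihilator (map eliminate φs) (s - a₀) → Annihilator (φ ∷ φs) s
      annihilator-∷-pivot {φs} {s} a₀∈s A = record
        { vector     = corrected
        ; support    = support
        ; support⊆s  = Subset.p─q⊆p s _ ∘ support⊆s
        ; large      = ℕ.≤-trans (∣p∣≤1+∣p-x∣ s a₀) (ℕ.≤-trans (s≤s large) (ℕ.≤-reflexive
                         (≡.trans (cong (λ m → suc (∣ support ∣ ℕ.+ m)) (List.length-map eliminate φs))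
                                  (≡.sym (ℕ.+-suc _ _)))))
        ; nonzero    = λ {a} a∈supp corrected≈0 → nonzero a∈supp (begin
                         vector a      ≈⟨ +-identityʳ _ ⟨
                         vector a + 0# ≈⟨ +-congˡ (ind-no (a Fin.≟ a₀) (≢a₀ (support⊆s a∈supp))) ⟨
                         corrected a   ≈⟨ corrected≈0 ⟩
                         0#            ∎)
        ; vanishes   = λ {a} a∉s → trans
                         (+-cong (vanishes (a∉s ∘ Subset.p─q⊆p s _))
                                 (ind-no (a Fin.≟ a₀) λ { ≡.refl → a∉s a₀∈s }))
                         (+-identityʳ 0#)
        ; orthogonal = corrected⟂φ ∷ All.map (corrected⟂ψ _) (All.map⁻ orthogonal)
        }
        where
        open Annihilator A
        open Corrected vector
        ≢a₀ : ∀ {a} → a ∈ₛ s - a₀ → a ≢ a₀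
        ≢a₀ a∈s-a₀ ≡.refl = x∉p-x s a₀ a∈s-a₀

  annihilator : ∀ {n} (φs : List (Fin n → Carrier)) (s : Subset n) → DoubleNegation (Annihilator φs s)
  annihilator φs = by-length (length φs) φs ≡.refl
    where
    by-length : ∀ {n} m (φs : List (Fin n → Carrier)) → length φs ≡ m → ∀ s →
                DoubleNegation (Annihilator φs s)
    by-length _       []       _   s = return (annihilator-[] s)
    by-length (suc m) (φ ∷ φs) len s = ¬¬-excluded-middle {A = ∃ λ a → a ∈ₛ s × ¬ φ a ≈ 0#} >>= λ where
      (yes (a₀ , a₀∈s , φa₀≉0)) → let open Pivot {φ = φ} φa₀≉0 in
        ¬¬-map (annihilator-∷-pivot a₀∈s)
          (by-length m (map eliminate φs) (≡.trans (List.length-map eliminate φs) (ℕ.suc-injective len)) (s - a₀))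
      (no no-pivot) →
        ¬¬-∀-Fin (λ a → ¬¬-excluded-middle {A = φ a ≈ 0#} >>= λ where
          (yes φa≈0) → return λ _ → φa≈0
          (no  φa≉0) → return λ a∈s → contradiction (a , a∈s , φa≉0) no-pivot) >>= λ φ≈0 →
        ¬¬-map (annihilator-∷-vanishing (φ≈0 _)) (by-length m φs (ℕ.suc-injective len) s)

module SliceRank {c ℓ} (F : Field c ℓ) where

  open OverField F hiding (zero; _-_)
  open Sums F
  open Annihilators F
  open import Relation.Binary.Reasoning.Setoid setoid

  DependsOnlyOn : ∀ {n k} → (Fin k → Bool) → Bool → (Tuple n k → Carrier) → Set ℓ
  DependsOnlyOn {n} {k} side β g =
    ∀ (x y : Tuple n k) → (∀ i → side i ≡ β → lookup x i ≡ lookup y i) → g x ≈ g y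

  record TwoBlockProduct {n k} (R : Tuple n k → Carrier) : Set (c ⊔ ℓ) where
    field
      side    : Fin k → Bool
      i₁      : Fin k
      i₁-side : side i₁ ≡ true
      i₂      : Fin k
      i₂-side : side i₂ ≡ false
      g h     : Tuple n k → Carrier
      g-local : DependsOnlyOn side true g
      h-local : DependsOnlyOn side false h
      R≈g*h   : ∀ x → R x ≈ g x * h x

  record FirstOnTrueSide {n k} (R : Tuple n (suc k) → Carrier) : Set (c ⊔ ℓ) where
    field
      product   : TwoBlockProduct R
      zero-side : TwoBlockProduct.side product zero ≡ true
    open TwoBlockProduct product public

  swap-sides : ∀ {n k} {R : Tuple n k → Carrier} → TwoBlockProduct R → TwoBlockProduct R
  swap-sides P = record
    { side    = not ∘ side
    ; i₁      = i₂
    ; i₁-side = cong not i₂-side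
    ; i₂      = i₁
    ; i₂-side = cong not i₁-side
    ; g       = h
    ; h       = g
    ; g-local = λ x y agree → h-local x y (λ i → agree i ∘ cong not)
    ; h-local = λ x y agree → g-local x y (λ i → agree i ∘ cong not)
    ; R≈g*h   = λ x → trans (R≈g*h x) (*-comm (g x) (h x))
    }
    where open TwoBlockProduct P

  firstOnTrueSide : ∀ {n k} {R : Tuple n (suc k) → Carrier} → TwoBlockProduct R → FirstOnTrueSide R
  firstOnTrueSide P with TwoBlockProduct.side P zero in eq
  ... | true  = record { product = P ; zero-side = eq }
  ... | false = record { product = swap-sides P ; zero-side = cong not eq }

  contract : ∀ {n k} → (Fin n → Carrier) → (Tuple n (suc k) → Carrier) → Tuple n k → Carrier
  contract {n} v R y = ∑[ a < n ] (v a * R (a ∷ y))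

  module _ {n k} {R : Tuple n (suc (suc k)) → Carrier} (P : FirstOnTrueSide R) where

    open FirstOnTrueSide P

    shares-first? : Dec (∃ λ j → side (suc j) ≡ true)
    shares-first? = Fin.any? (λ j → side (suc j) Bool.≟ true)

    diagonalOfFirstFactor : Fin n → Carrier
    diagonalOfFirstFactor a = g (replicate _ a)

    h-ignores-first : ∀ a y → h (a ∷ y) ≈ h (Vec.head y ∷ y)
    h-ignores-first a y = h-local _ _ λ where
      zero    eq → contradiction (≡.trans (≡.sym zero-side) eq) λ ()
      (suc i) _  → ≡.refl

    contract-lone : ¬ (∃ λ j → side (suc j) ≡ true) → ∀ v → v ⟂ diagonalOfFirstFactor →
                    ∀ y → contract v R y ≈ 0#
    contract-lone alone v v⟂ y = begin
      ∑[ a < n ] (v a * R (a ∷ y))                 ≈⟨ sum-cong-≋ (λ a → *-congˡ (trans (R≈g*h (a ∷ y))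
                                                        (*-cong (g-diagonal a) (h-ignores-first a y)))) ⟩
      ∑[ a < n ] (v a * (diagonalOfFirstFactor a * H)) ≈⟨ sum-cong-≋ (λ a → *-assoc (v a) _ H) ⟨
      ∑[ a < n ] ((v a * diagonalOfFirstFactor a) * H) ≈⟨ *-distribʳ-sum H (λ a → v a * diagonalOfFirstFactor a) ⟨
      ∑[ a < n ] (v a * diagonalOfFirstFactor a) * H   ≈⟨ *-congʳ v⟂ ⟩
      0# * H                                       ≈⟨ zeroˡ H ⟩
      0#                                           ∎
      where
      H = h (Vec.head y ∷ y)
      g-diagonal : ∀ a → g (a ∷ y) ≈ diagonalOfFirstFactor a
      g-diagonal a = g-local _ _ λ where
        zero    _  → ≡.refl
        (suc j) eq → contradiction (j , eq) alone

    contract-twoBlock : ∀ {j} → side (suc j) ≡ true → ∀ v → TwoBlockProduct (contract v R)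
    contract-twoBlock {j} j-side v = record
      { side    = side ∘ suc
      ; i₁      = j
      ; i₁-side = j-side
      ; i₂      = proj₁ i₂-pred
      ; i₂-side = proj₂ i₂-pred
      ; g       = λ y → ∑[ a < n ] (v a * g (a ∷ y))
      ; h       = λ y → h (Vec.head y ∷ y)
      ; g-local = λ y y′ agree → sum-cong-≋ λ a → *-congˡ (g-local (a ∷ y) (a ∷ y′) λ where
                    zero    _  → ≡.refl
                    (suc i) eq → agree i eq)
      ; h-local = λ y y′ agree → h-local _ _ λ where
                    zero    eq → contradiction (≡.trans (≡.sym zero-side) eq) λ ()
                    (suc i) eq → agree i eq
      ; R≈g*h   = λ y → begin
          ∑[ a < n ] (v a * R (a ∷ y))
            ≈⟨ sum-cong-≋ (λ a → *-congˡ (trans (R≈g*h (a ∷ y)) (*-congˡ (h-ignores-first a y)))) ⟩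
          ∑[ a < n ] (v a * (g (a ∷ y) * h (Vec.head y ∷ y)))
            ≈⟨ sum-cong-≋ (λ a → *-assoc (v a) _ _) ⟨
          ∑[ a < n ] ((v a * g (a ∷ y)) * h (Vec.head y ∷ y))
            ≈⟨ *-distribʳ-sum (h (Vec.head y ∷ y)) (λ a → v a * g (a ∷ y)) ⟨
          ∑[ a < n ] (v a * g (a ∷ y)) * h (Vec.head y ∷ y) ∎
      }
      where
      i₂-pred : ∃ λ i → side (suc i) ≡ false
      i₂-pred with i₂ | i₂-side
      ... | zero  | eq = contradiction (≡.trans (≡.sym zero-side) eq) λ ()
      ... | suc i | eq = i , eq

  record Decomposition {n k} (D : Tuple n k → Carrier) : Set (c ⊔ ℓ) where
    field
      terms    : List (Tuple n k → Carrier)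
      products : All TwoBlockProduct terms
      D≈sum    : ∀ x → D x ≈ sumF (map (λ R → R x) terms)

  module _ {n k : ℕ} where

    loneFunctionals : {Rs : List (Tuple n (suc (suc k)) → Carrier)} →
                      All FirstOnTrueSide Rs → List (Fin n → Carrier)
    loneFunctionals []       = []
    loneFunctionals (P ∷ Ps) with shares-first? P
    ... | yes _ = loneFunctionals Ps
    ... | no  _ = diagonalOfFirstFactor P ∷ loneFunctionals Ps

    -- Contracting the first coordinate against v kills the terms whose first block is {0}.
    contractAll : ∀ v {Rs} (Ps : All FirstOnTrueSide Rs) → All (v ⟂_) (loneFunctionals Ps) →
                  Σ (Decomposition (λ y → sumF (map (λ R → contract v R y) Rs))) λ Δ →
                    length Rs ≡ length (Decomposition.terms Δ) ℕ.+ length (loneFunctionals Ps)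
    contractAll v []       _ = record { terms = [] ; products = [] ; D≈sum = λ _ → refl } , ≡.refl
    contractAll v {R ∷ Rs} (P ∷ Ps) v⟂ with shares-first? P
    contractAll v {R ∷ Rs} (P ∷ Ps) v⟂         | yes (j , j-side) with contractAll v Ps v⟂
    ... | Δ , |Rs| = record
      { terms    = contract v R ∷ terms
      ; products = contract-twoBlock P j-side v ∷ products
      ; D≈sum    = λ y → +-congˡ (D≈sum y)
      } , cong suc |Rs|
      where open Decomposition Δ
    contractAll v {R ∷ Rs} (P ∷ Ps) (v⟂φ ∷ v⟂) | no alone with contractAll v Ps v⟂
    ... | Δ , |Rs| = record
      { terms    = terms
      ; products = products
      ; D≈sum    = λ y → trans (+-congʳ (contract-lone P alone v v⟂φ y)) (trans (+-identityˡ _) (D≈sum y))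
      } , ≡.trans (cong suc |Rs|) (≡.sym (ℕ.+-suc _ _))
      where open Decomposition Δ

  NonConstant : ∀ {n k} → Tuple n k → Set
  NonConstant {n} {k} x = ∀ a → x ≢ replicate k a

  record IsDiagonal {n k} (s : Subset n) (D : Tuple n k → Carrier) : Set ℓ where
    field
      diagonal≉0    : ∀ {a} → a ∈ₛ s → ¬ D (replicate k a) ≈ 0#
      offDiagonal≈0 : ∀ x → NonConstant x → D x ≈ 0#

  contract-isDiagonal : ∀ {n k} {s : Subset n} {D : Tuple n (suc (suc k)) → Carrier} {φs} →
                        IsDiagonal s D → (A : Annihilator φs s) →
                        IsDiagonal (Annihilator.support A) (contract (Annihilator.vector A) D)
  contract-isDiagonal {n} {k} {D = D} isDiagonal A = record
    { diagonal≉0    = λ {b} b∈supp contraction≈0 →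
        x≉0∧y≉0⇒x*y≉0 (nonzero b∈supp) (diagonal≉0 (support⊆s b∈supp))
          (trans (sym (sum-single _ b λ a a≢b → trans (*-congˡ (offDiagonal≈0 _ (cons-nonConstant a≢b))) (zeroʳ _)))
                 contraction≈0)
    ; offDiagonal≈0 = λ y y-nonConstant → sum-zero λ a →
        trans (*-congˡ (offDiagonal≈0 (a ∷ y) λ b eq → y-nonConstant b (Vec.∷-injectiveʳ eq))) (zeroʳ _)
    }
    where
    open IsDiagonal isDiagonal
    open Annihilator A
    cons-nonConstant : ∀ {a b} → a ≢ b → NonConstant (a ∷ replicate (suc k) b)
    cons-nonConstant a≢b c eq =
      a≢b (≡.trans (Vec.∷-injectiveˡ eq) (≡.sym (Vec.∷-injectiveˡ (Vec.∷-injectiveʳ eq))))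

  contract-sumF : ∀ {n k} {D : Tuple n (suc k) → Carrier} (v : Fin n → Carrier) Rs →
                  (∀ x → D x ≈ sumF (map (λ R → R x) Rs)) →
                  ∀ y → contract v D y ≈ sumF (map (λ R → contract v R y) Rs)
  contract-sumF {n} {D = D} v Rs D≈sum y = begin
    ∑[ a < n ] (v a * D (a ∷ y))
      ≈⟨ sum-cong-≋ (λ a → *-congˡ (D≈sum (a ∷ y))) ⟩
    ∑[ a < n ] (v a * sumF (map (λ R → R (a ∷ y)) Rs))
      ≈⟨ sum-cong-≋ (λ a → *-distribˡ-sumF (v a) (λ R → R (a ∷ y)) Rs) ⟩
    ∑[ a < n ] (sumF (map (λ R → v a * R (a ∷ y)) Rs))
      ≈⟨ sum-sumF (λ R a → v a * R (a ∷ y)) Rs ⟩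
    sumF (map (λ R → contract v R y) Rs)
      ∎

  -- Contract the first coordinate against a vector annihilating the terms whose first block
  -- is {0}, and induct on the number of coordinates.
  diagonal-bound : ∀ {n} k {s : Subset n} {D : Tuple n (suc k) → Carrier} → IsDiagonal s D →
                   (Δ : Decomposition D) → DoubleNegation (∣ s ∣ ≤ length (Decomposition.terms Δ))
  diagonal-bound {n} zero {s} isDiagonal record { terms = [] ; D≈sum = D≈0 } =
    return (ℕ.≤-reflexive (≡.trans (cong ∣_∣ (Subset.Empty-unique s-empty)) (Subset.∣⊥∣≡0 n)))
    where
    s-empty : ¬ ∃ λ a → a ∈ₛ s
    s-empty (a , a∈s) = IsDiagonal.diagonal≉0 isDiagonal a∈s (D≈0 _)
  diagonal-bound zero _ record { terms = _ ∷ _ ; products = P ∷ _ } with P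
  ... | record { i₁ = zero ; i₁-side = i₁-side ; i₂ = zero ; i₂-side = i₂-side } =
    contradiction (≡.trans (≡.sym i₁-side) i₂-side) λ ()
  diagonal-bound (suc k) {s} {D} isDiagonal Δ =
    annihilator (loneFunctionals Ps) s >>= λ A →
    let open Annihilator A
        (Δ′ , |terms|≡) = contractAll vector Ps orthogonal
        open Decomposition Δ′ renaming (terms to terms′; D≈sum to D≈sum′)
    in
    diagonal-bound k (contract-isDiagonal isDiagonal A) record
      { terms    = terms′
      ; products = Decomposition.products Δ′
      ; D≈sum    = λ y → trans (contract-sumF vector terms D≈sum y) (D≈sum′ y)
      } >>= λ bound → return (ℕ.≤-trans large
        (ℕ.≤-trans (ℕ.+-monoˡ-≤ _ bound) (ℕ.≤-reflexive (≡.sym |terms|≡))))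
    where
    open Decomposition Δ
    Ps = All.map firstOnTrueSide products

  partitionRankOne⇒twoBlockProduct : ∀ {n k} {R : Tuple n (suc k) → Carrier} →
                                     PartitionRankOne R → TwoBlockProduct R
  partitionRankOne⇒twoBlockProduct {n} {k} {R} (σ , σ-part , two-blocks , Ts , Ts-local , R≈∏) = record
    { side    = λ i → does (lookup σ i Fin.≟ zero)
    ; i₁      = zero
    ; i₁-side = dec-true (lookup σ zero Fin.≟ zero) σ₀≡0
    ; i₂      = suc (proj₁ second-block)
    ; i₂-side = dec-false (lookup σ _ Fin.≟ zero) λ σᵢ≡0 → 0≢suc (≡.trans (≡.sym σᵢ≡0) (proj₂ second-block))
    ; g       = Ts zero
    ; h       = λ x → prodF (map (λ b → Ts b x) later-blocks)
    ; g-local = λ x y agree → Ts-local zero σ₀≡0 x y λ i σᵢ≡0 → agree i (dec-true (lookup σ i Fin.≟ zero) σᵢ≡0)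
    ; h-local = λ x y agree → prodF-cong (All.map (λ { {b} (b-block , b′ , ≡.refl) →
                  Ts-local b b-block x y λ i σᵢ≡b → agree i (dec-false (lookup σ i Fin.≟ zero)
                    λ σᵢ≡0 → 0≢suc (≡.trans (≡.sym σᵢ≡0) σᵢ≡b)) }) later-blocks-shape)
    ; R≈g*h   = λ x → trans (R≈∏ x) (reflexive
                  (cong (λ bs → prodF (map (λ b → Ts b x) bs)) (List.filter-accept (isBlock? σ) σ₀≡0)))
    }
    where
    0≢suc : ∀ {i : Fin k} → zero ≢ suc i
    0≢suc ()
    σ₀≡0 : lookup σ zero ≡ zero
    σ₀≡0 = Fin.≤-antisym (proj₁ (σ-part zero)) z≤n
    later-blocks : List (Fin (suc k))
    later-blocks = filter (isBlock? σ) (List.tabulate {n = k} suc)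
    later-blocks-shape : All (λ b → IsBlock σ b × ∃ λ b′ → b ≡ suc b′) later-blocks
    later-blocks-shape = All.zip (All.all-filter (isBlock? σ) (List.tabulate {n = k} suc) ,
                                  All.filter⁺ (isBlock? σ) (All.tabulate⁺ (λ b′ → b′ , ≡.refl)))
    second-block : ∃ λ b → IsBlock σ (suc b)
    second-block with Fin.any? (λ b → isBlock? σ (suc b))
    ... | yes block = block
    ... | no  none  = contradiction two-blocks λ 2≤numBlocks → ℕ.<-irrefl ≡.refl (ℕ.<-≤-trans 2≤numBlocks
      (ℕ.≤-reflexive (≡.trans (cong length (List.filter-accept (isBlock? σ) σ₀≡0))
        (cong (suc ∘ length) (List.filter-none (isBlock? σ) (All.tabulate⁺ (λ b b-block → none (b , b-block))))))))

module PartitionIndicator {c ℓ} (F : Field c ℓ) where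

  open OverField F hiding (zero; _-_)
  open Sums F
  open import Algebra.Properties.Ring ring using (-0#≈0#; -‿+-comm; -‿involutive; -‿distribʳ-*)
  open import Relation.Binary.Reasoning.Setoid setoid

  ℕ→F-+ : ∀ m n → ℕ→F (m ℕ.+ n) ≈ ℕ→F m + ℕ→F n
  ℕ→F-+ zero    n = sym (+-identityˡ _)
  ℕ→F-+ (suc m) n = trans (+-congˡ (ℕ→F-+ m n)) (sym (+-assoc _ _ _))

  ℤ→F-⊖ : ∀ m n → ℤ→F (m ℤ.⊖ n) ≈ ℕ→F m + - ℕ→F n
  ℤ→F-⊖ zero    zero    = sym (-‿inverseʳ 0#)
  ℤ→F-⊖ (suc m) zero    = sym (trans (+-congˡ -0#≈0#) (+-identityʳ _))
  ℤ→F-⊖ zero    (suc n) = sym (+-identityˡ _)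
  ℤ→F-⊖ (suc m) (suc n) = begin
    ℤ→F (suc m ℤ.⊖ suc n)              ≡⟨ cong ℤ→F (ℤ.[1+m]⊖[1+n]≡m⊖n m n) ⟩
    ℤ→F (m ℤ.⊖ n)                      ≈⟨ ℤ→F-⊖ m n ⟩
    ℕ→F m + - ℕ→F n                    ≈⟨ +-congˡ (+-identityˡ _) ⟨
    ℕ→F m + (0# + - ℕ→F n)             ≈⟨ +-congˡ (+-congʳ (-‿inverseʳ 1#)) ⟨
    ℕ→F m + ((1# + - 1#) + - ℕ→F n)    ≈⟨ +-congˡ (+-assoc 1# (- 1#) _) ⟩
    ℕ→F m + (1# + (- 1# + - ℕ→F n))    ≈⟨ +-assoc (ℕ→F m) 1# _ ⟨
    (ℕ→F m + 1#) + (- 1# + - ℕ→F n)    ≈⟨ +-cong (+-comm (ℕ→F m) 1#) (-‿+-comm 1# (ℕ→F n)) ⟩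
    ℕ→F (suc m) + - ℕ→F (suc n)        ∎

  ℤ→F-+ : ∀ i j → ℤ→F (i ℤ.+ j) ≈ ℤ→F i + ℤ→F j
  ℤ→F-+ -[1+ m ] -[1+ n ] = trans (-‿cong (trans
    (reflexive (cong (ℕ→F ∘ suc) (≡.sym (ℕ.+-suc m n)))) (ℕ→F-+ (suc m) (suc n)))) (sym (-‿+-comm _ _))
  ℤ→F-+ -[1+ m ] (+ n)    = trans (ℤ→F-⊖ n (suc m)) (+-comm _ _)
  ℤ→F-+ (+ m)    -[1+ n ] = ℤ→F-⊖ m (suc n)
  ℤ→F-+ (+ m)    (+ n)    = ℕ→F-+ m n

  ℤ→F-neg : ∀ i → ℤ→F (ℤ.- i) ≈ - ℤ→F i
  ℤ→F-neg (+ zero)  = sym -0#≈0#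
  ℤ→F-neg (+ suc n) = refl
  ℤ→F-neg -[1+ n ]  = sym (-‿involutive _)

  ℤ→F-sumℤ : ∀ is → ℤ→F (sumℤ is) ≈ sumF (map ℤ→F is)
  ℤ→F-sumℤ []       = refl
  ℤ→F-sumℤ (i ∷ is) = trans (ℤ→F-+ i _) (+-congˡ (ℤ→F-sumℤ is))

  hasPartition-partitionOf : ∀ {n k} (x : Tuple n k) → HasPartition x (partitionOf x)
  hasPartition-partitionOf x i j = Equivalence.from (sameBlock-partitionOf x i j) ,
                                   Equivalence.to (sameBlock-partitionOf x i j)

  hasPartition-top : ∀ {n k} (a : Fin n) → HasPartition (replicate (suc k) a) (top (suc k))
  hasPartition-top a i j = (λ _ → sameBlock-top i j) ,
    (λ _ → ≡.trans (Vec.lookup-replicate i a) (≡.sym (Vec.lookup-replicate j a)))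

  module _ {k : ℕ} where

    μ̂ : Labels (suc k) → Labels (suc k) → Carrier
    μ̂ π σ = ℤ→F (μ π σ)

    μ̂-refl : ∀ π → μ̂ π π ≈ 1#
    μ̂-refl π = trans (reflexive (cong ℤ→F (μ-fuel-refl (suc k) {π} ≡.refl))) (+-identityʳ 1#)

    sum-μ̂-between : ∀ {π σ} → IsSetPartition π → IsSetPartition σ → π ≢ σ → π ≼ σ →
                    sumF (map (μ̂ π) (filter (between? π σ) (Π (suc k)))) ≈ - μ̂ π σ
    sum-μ̂-between {π} {σ} π-part σ-part π≢σ π≼σ = begin
      X                                ≈⟨ -‿involutive X ⟨
      - - X                            ≡⟨ cong (λ zs → - - sumF zs) (List.map-∘ between-π-σ) ⟩
      - - sumF (map ℤ→F (map (μ π) between-π-σ)) ≈⟨ -‿cong (-‿cong (ℤ→F-sumℤ μs)) ⟨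
      - - ℤ→F (sumℤ μs)                          ≈⟨ -‿cong (ℤ→F-neg (sumℤ μs)) ⟨
      - ℤ→F (ℤ.- sumℤ μs)                        ≡⟨ cong (λ i → - ℤ→F i) (μ-recursion π-part σ-part π≢σ π≼σ) ⟨
      - μ̂ π σ                          ∎
      where
      between-π-σ = filter (between? π σ) (Π (suc k))
      μs = map (μ π) between-π-σ
      X = sumF (map (μ̂ π) between-π-σ)

    weight : Labels (suc k) → Labels (suc k) → Carrier
    weight ρ π = sumF (map (λ τ → ind (τ ≺? top (suc k)) (ind (τ ≼? ρ) (ind (π ≼? τ) (μ̂ π τ)))) (Π (suc k)))

    I-expansion : ∀ {n} (f : Labels (suc k) → Carrier) (x : Tuple n (suc k)) ρ →
                  (∀ τ → δ τ x ≈ ind (τ ≼? ρ) 1#) →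
                  I f x ≈ sumF (map (λ π → f π * weight ρ π) (Π (suc k)))
    I-expansion f x ρ δ≈ = begin
      I f x                                                ≈⟨ sumF-filter (_≺? 1̂) _ L ⟩
      sumF (map (λ τ → ind (τ ≺? 1̂) (N τ * δ τ x)) L)    ≈⟨ sumF-cong (All.universal expand-τ L) ⟩
      sumF (map (λ τ → sumF (map (G τ) L)) L)              ≈⟨ sumF-comm G L L ⟩
      sumF (map (λ π → sumF (map (λ τ → G τ π) L)) L)      ≈⟨ sumF-cong (All.universal collect-π L) ⟩
      sumF (map (λ π → f π * weight ρ π) L)                ∎
      where
      L  = Π (suc k)
      1̂ = top (suc k)
      N : Labels (suc k) → Carrier
      N τ = ΣΠ (suc k) (_≼? τ) (λ π → f π * μ̂ π τ)
      G : Labels (suc k) → Labels (suc k) → Carrier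
      G τ π = ind (τ ≺? 1̂) (ind (τ ≼? ρ) (ind (π ≼? τ) (f π * μ̂ π τ)))
      expand-τ : ∀ τ → ind (τ ≺? 1̂) (N τ * δ τ x) ≈ sumF (map (G τ) L)
      expand-τ τ = trans (ind-cong (τ ≺? 1̂) (begin
        N τ * δ τ x                                                ≈⟨ *-congˡ (δ≈ τ) ⟩
        N τ * ind (τ ≼? ρ) 1#                                      ≈⟨ *-ind-1 (τ ≼? ρ) (N τ) ⟩
        ind (τ ≼? ρ) (N τ)                                         ≈⟨ ind-cong (τ ≼? ρ) (sumF-filter (_≼? τ) _ L) ⟩
        ind (τ ≼? ρ) (sumF (map (λ π → ind (π ≼? τ) (f π * μ̂ π τ)) L)) ≈⟨ ind-sumF (τ ≼? ρ) _ L ⟩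
        sumF (map (λ π → ind (τ ≼? ρ) (ind (π ≼? τ) (f π * μ̂ π τ))) L) ∎))
        (ind-sumF (τ ≺? 1̂) _ L)
      collect-π : ∀ π → sumF (map (λ τ → G τ π) L) ≈ f π * weight ρ π
      collect-π π = trans (sumF-cong (All.universal (λ τ →
          trans (ind-cong (τ ≺? 1̂) (trans (ind-cong (τ ≼? ρ) (ind-*ˡ (π ≼? τ) _ _)) (ind-*ˡ (τ ≼? ρ) _ _)))
                (ind-*ˡ (τ ≺? 1̂) _ _)) L))
        (sym (*-distribˡ-sumF (f π) _ L))

    module _ {π σ : Labels (suc k)} (π-part : IsSetPartition π) (σ-part : IsSetPartition σ) where

      strictlyBetween : Labels (suc k) → Carrier
      strictlyBetween τ = ind (between? π σ τ) (μ̂ π τ)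

      sum-μ̂-interval : sumF (map strictlyBetween (Π (suc k))) + ind (π ≼? σ) (μ̂ π σ) ≈ ind (π ≟ σ) 1#
      sum-μ̂-interval = by-cases (π ≟ σ) (π ≼? σ)
        where
        L = Π (suc k)
        by-cases : Dec (π ≡ σ) → Dec (π ≼ σ) →
                   sumF (map strictlyBetween L) + ind (π ≼? σ) (μ̂ π σ) ≈ ind (π ≟ σ) 1#
        by-cases (yes ≡.refl) _ = begin
          sumF (map strictlyBetween L) + ind (π ≼? π) (μ̂ π π)
            ≈⟨ +-cong (sumF-zero (All.map nothing-between Π-sound))
                      (trans (ind-yes (π ≼? π) (λ _ _ eq → eq)) (μ̂-refl π)) ⟩
          0# + 1#        ≈⟨ +-identityˡ 1# ⟩
          1#             ≈⟨ ind-yes (π ≟ π) ≡.refl ⟨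
          ind (π ≟ π) 1# ∎
          where
          nothing-between : ∀ {τ} → IsSetPartition τ → strictlyBetween τ ≈ 0#
          nothing-between {τ} τ-part = ind-no (between? π π τ) λ (π≼τ , τ≼π , τ≢π) →
            τ≢π (≼-antisym τ-part π-part τ≼π π≼τ)
        by-cases (no π≢σ) (yes π≼σ) = begin
          sumF (map strictlyBetween L) + ind (π ≼? σ) (μ̂ π σ)
            ≈⟨ +-congʳ (sumF-filter (between? π σ) (μ̂ π) L) ⟨
          sumF (map (μ̂ π) (filter (between? π σ) L)) + ind (π ≼? σ) (μ̂ π σ)
            ≈⟨ +-cong (sum-μ̂-between π-part σ-part π≢σ π≼σ) (ind-yes (π ≼? σ) π≼σ) ⟩
          - μ̂ π σ + μ̂ π σ ≈⟨ -‿inverseˡ (μ̂ π σ) ⟩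
          0#              ≈⟨ ind-no (π ≟ σ) π≢σ ⟨
          ind (π ≟ σ) 1#  ∎
        by-cases (no π≢σ) (no π⋠σ) = begin
          sumF (map strictlyBetween L) + ind (π ≼? σ) (μ̂ π σ)
            ≈⟨ +-cong (sumF-zero (All.universal (λ τ → ind-no (between? π σ τ) λ (π≼τ , τ≼σ , _) →
                                                   π⋠σ λ i j → τ≼σ i j ∘ π≼τ i j) L))
                      (ind-no (π ≼? σ) π⋠σ) ⟩
          0# + 0#        ≈⟨ +-identityʳ 0# ⟩
          0#             ≈⟨ ind-no (π ≟ σ) π≢σ ⟨
          ind (π ≟ σ) 1# ∎

      weight-summand : σ ≢ top (suc k) → ∀ τ →
                       ind (τ ≺? top (suc k)) (ind (τ ≼? σ) (ind (π ≼? τ) (μ̂ π τ))) ≈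
                       strictlyBetween τ + ind (τ ≟ σ) (ind (π ≼? τ) (μ̂ π τ))
      weight-summand σ≢1̂ τ = by-cases (τ ≟ σ) (τ ≼? σ)
        where
        1̂ = top (suc k)
        μ̂≥π = ind (π ≼? τ) (μ̂ π τ)
        by-cases : Dec (τ ≡ σ) → Dec (τ ≼ σ) →
                   ind (τ ≺? 1̂) (ind (τ ≼? σ) μ̂≥π) ≈ strictlyBetween τ + ind (τ ≟ σ) μ̂≥π
        by-cases (yes τ≡σ) _ = begin
          ind (τ ≺? 1̂) (ind (τ ≼? σ) μ̂≥π)
            ≈⟨ ind-yes (τ ≺? 1̂) (≼-top τ , σ≢1̂ ∘ ≡.trans (≡.sym τ≡σ)) ⟩
          ind (τ ≼? σ) μ̂≥π                ≈⟨ ind-yes (τ ≼? σ) (subst (τ ≼_) τ≡σ (λ _ _ eq → eq)) ⟩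
          μ̂≥π                             ≈⟨ ind-yes (τ ≟ σ) τ≡σ ⟨
          ind (τ ≟ σ) μ̂≥π                 ≈⟨ +-identityˡ _ ⟨
          0# + ind (τ ≟ σ) μ̂≥π
            ≈⟨ +-congʳ (ind-no (between? π σ τ) λ (_ , _ , τ≢σ) → τ≢σ τ≡σ) ⟨
          strictlyBetween τ + ind (τ ≟ σ) μ̂≥π ∎
        by-cases (no τ≢σ) (yes τ≼σ) = begin
          ind (τ ≺? 1̂) (ind (τ ≼? σ) μ̂≥π) ≈⟨ ind-yes (τ ≺? 1̂) (≼-top τ , τ≢1̂) ⟩
          ind (τ ≼? σ) μ̂≥π                ≈⟨ ind-yes (τ ≼? σ) τ≼σ ⟩
          μ̂≥π
            ≈⟨ ind-⇔ (π ≼? τ) (between? π σ τ) (mk⇔ (_, τ≼σ , τ≢σ) proj₁) ⟩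
          strictlyBetween τ               ≈⟨ +-identityʳ _ ⟨
          strictlyBetween τ + 0#          ≈⟨ +-congˡ (ind-no (τ ≟ σ) τ≢σ) ⟨
          strictlyBetween τ + ind (τ ≟ σ) μ̂≥π ∎
          where
          τ≢1̂ : τ ≢ 1̂
          τ≢1̂ τ≡1̂ = σ≢1̂ (≼-antisym σ-part top-isSetPartition (≼-top σ) (subst (_≼ σ) τ≡1̂ τ≼σ))
        by-cases (no τ≢σ) (no τ⋠σ) = begin
          ind (τ ≺? 1̂) (ind (τ ≼? σ) μ̂≥π) ≈⟨ ind-cong (τ ≺? 1̂) (ind-no (τ ≼? σ) τ⋠σ) ⟩
          ind (τ ≺? 1̂) 0#                 ≈⟨ ind-zero (τ ≺? 1̂) ⟩
          0#                              ≈⟨ +-identityʳ 0# ⟨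
          0# + 0#
            ≈⟨ +-cong (ind-no (between? π σ τ) (τ⋠σ ∘ proj₁ ∘ proj₂)) (ind-no (τ ≟ σ) τ≢σ) ⟨
          strictlyBetween τ + ind (τ ≟ σ) μ̂≥π ∎

      weight-below : σ ≢ top (suc k) → weight σ π ≈ ind (π ≟ σ) 1#
      weight-below σ≢1̂ = begin
        weight σ π
          ≈⟨ sumF-cong (All.universal (weight-summand σ≢1̂) L) ⟩
        sumF (map (λ τ → strictlyBetween τ + at τ) L)
          ≈⟨ sumF-+ strictlyBetween at L ⟩
        sumF (map strictlyBetween L) + sumF (map at L)
          ≈⟨ +-congˡ (sumF-single _≟_ (λ τ → ind (π ≼? τ) (μ̂ π τ)) Π-unique (Π-complete σ-part)) ⟩
        sumF (map strictlyBetween L) + ind (π ≼? σ) (μ̂ π σ)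
          ≈⟨ sum-μ̂-interval ⟩
        ind (π ≟ σ) 1#
          ∎
        where
        L = Π (suc k)
        at : Labels (suc k) → Carrier
        at τ = ind (τ ≟ σ) (ind (π ≼? τ) (μ̂ π τ))

    weight-top : ∀ {π} → IsSetPartition π →
                 weight (top (suc k)) π ≈ - ind (π ≺? top (suc k)) (μ̂ π (top (suc k)))
    weight-top {π} π-part = trans (sumF-cong (All.universal summand L)) (by-cases (π ≟ 1̂))
      where
      L  = Π (suc k)
      1̂ = top (suc k)
      summand : ∀ τ → ind (τ ≺? 1̂) (ind (τ ≼? 1̂) (ind (π ≼? τ) (μ̂ π τ))) ≈
                      ind (between? π 1̂ τ) (μ̂ π τ)
      summand τ = trans (ind-cong (τ ≺? 1̂) (ind-yes (τ ≼? 1̂) (≼-top τ))) (ind-ind (τ ≺? 1̂) (π ≼? τ) _)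
      by-cases : Dec (π ≡ 1̂) →
                 sumF (map (λ τ → ind (between? π 1̂ τ) (μ̂ π τ)) L) ≈ - ind (π ≺? 1̂) (μ̂ π 1̂)
      by-cases (yes ≡.refl) = begin
        sumF (map (λ τ → ind (between? 1̂ 1̂ τ) (μ̂ 1̂ τ)) L)
          ≈⟨ sumF-zero (All.map (λ {τ} → nothing-between {τ}) Π-sound) ⟩
        0#                      ≈⟨ -0#≈0# ⟨
        - 0#                    ≈⟨ -‿cong (ind-no (1̂ ≺? 1̂) λ (_ , 1̂≢1̂) → 1̂≢1̂ ≡.refl) ⟨
        - ind (1̂ ≺? 1̂) (μ̂ 1̂ 1̂) ∎
        where
        nothing-between : ∀ {τ} → IsSetPartition τ → ind (between? 1̂ 1̂ τ) (μ̂ 1̂ τ) ≈ 0#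
        nothing-between {τ} τ-part = ind-no (between? 1̂ 1̂ τ) λ (1̂≼τ , _ , τ≢1̂) →
          τ≢1̂ (≼-antisym τ-part top-isSetPartition (≼-top τ) 1̂≼τ)
      by-cases (no π≢1̂) = begin
        sumF (map (λ τ → ind (between? π 1̂ τ) (μ̂ π τ)) L)
          ≈⟨ sumF-filter (between? π 1̂) (μ̂ π) L ⟨
        sumF (map (μ̂ π) (filter (between? π 1̂) L))
          ≈⟨ sum-μ̂-between π-part top-isSetPartition π≢1̂ (≼-top π) ⟩
        - μ̂ π 1̂                ≈⟨ -‿cong (ind-yes (π ≺? 1̂) (≼-top π , π≢1̂)) ⟨
        - ind (π ≺? 1̂) (μ̂ π 1̂) ∎

    δ-hasPartition : ∀ {n} {x : Tuple n (suc k)} {ρ} → HasPartition x ρ → ∀ τ → δ τ x ≈ ind (τ ≼? ρ) 1#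
    δ-hasPartition {x = x} {ρ} x~ρ τ = ind-⇔
      (Fin.all? λ i → Fin.all? λ j → (lookup τ i Fin.≟ lookup τ j) →-dec (lookup x i Fin.≟ lookup x j))
      (τ ≼? ρ)
      (mk⇔ (λ τ⇒x i j → proj₁ (x~ρ i j) ∘ τ⇒x i j) (λ τ≼ρ i j → proj₂ (x~ρ i j) ∘ τ≼ρ i j))

    I-below-top : ∀ {n} (f : Labels (suc k) → Carrier) (x : Tuple n (suc k)) {σ} → IsSetPartition σ →
                  HasPartition x σ → σ ≢ top (suc k) → I f x ≈ f σ
    I-below-top f x {σ} σ-part x~σ σ≢1̂ = begin
      I f x
        ≈⟨ I-expansion f x σ (δ-hasPartition {x = x} {σ} x~σ) ⟩
      sumF (map (λ π → f π * weight σ π) L)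
        ≈⟨ sumF-cong (All.map (λ {π} π-part → *-congˡ (weight-below {π} {σ} π-part σ-part σ≢1̂)) Π-sound) ⟩
      sumF (map (λ π → f π * ind (π ≟ σ) 1#) L)
        ≈⟨ sumF-cong (All.universal (λ π → *-ind-1 (π ≟ σ) (f π)) L) ⟩
      sumF (map (λ π → ind (π ≟ σ) (f π)) L)
        ≈⟨ sumF-single _≟_ f Π-unique (Π-complete σ-part) ⟩
      f σ
        ∎
      where L = Π (suc k)

    I-top : ∀ {n} (f : Labels (suc k) → Carrier) (x : Tuple n (suc k)) → HasPartition x (top (suc k)) →
            I f x ≈ - ΣΠ (suc k) (_≺? top (suc k)) (λ π → f π * μ̂ π (top (suc k)))
    I-top f x x~1̂ = begin
      I f x
        ≈⟨ I-expansion f x 1̂ (δ-hasPartition {x = x} {1̂} x~1̂) ⟩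
      sumF (map (λ π → f π * weight 1̂ π) L)
        ≈⟨ sumF-cong (All.map (λ {π} π-part → *-congˡ (weight-top {π} π-part)) Π-sound) ⟩
      sumF (map (λ π → f π * - ind (π ≺? 1̂) (μ̂ π 1̂)) L)
        ≈⟨ sumF-cong (All.universal (λ π →
             trans (-‿cong (ind-*ˡ (π ≺? 1̂) (f π) _)) (-‿distribʳ-* (f π) _)) L) ⟨
      sumF (map (λ π → - ind (π ≺? 1̂) (f π * μ̂ π 1̂)) L)
        ≈⟨ sumF-neg _ L ⟩
      - sumF (map (λ π → ind (π ≺? 1̂) (f π * μ̂ π 1̂)) L)
        ≈⟨ -‿cong (sumF-filter (_≺? 1̂) _ L) ⟨
      - ΣΠ (suc k) (_≺? 1̂) (λ π → f π * μ̂ π 1̂)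
        ∎
      where
      L  = Π (suc k)
      1̂ = top (suc k)

mainTheorem2 : ∀ {c ℓ} (F : Field c ℓ) → let open OverField F in
    (k n : ℕ) → 1 ≤ k →
    (P : Tuple n k → Set) (T : Tuple n k → Carrier) (f : Labels k → Carrier) →
    (∀ (a : Fin n) → P (replicate k a)) →
    (∀ x → (P x → T x ≈ 1#) × (¬ P x → T x ≈ 0#)) →
    (∀ π → IsSetPartition π → π ≢ top k → (∃ λ x → HasPartition x π × P x) → f π ≈ 0#) →
    ¬ (ΣΠ k (_≺? top k) (λ π → f π * ℤ→F (μ π (top k))) ≈ 0#) →
    n ≤PartitionRank (λ x → I f x * T x)
mainTheorem2 F (suc k) n (s≤s z≤n) P T f P-diagonal T-indicator f-vanishes ∑≉0
             r (Rs , |Rs|≡r , rank-one , I·T≈∑Rs) =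
  decidable-stable (n ℕ.≤? r) (
    ¬¬-∀-Vec vanishes-off-diagonal >>= λ offDiagonal≈0 →
    diagonal-bound k {⊤ₛ} record { diagonal≉0 = λ {a} _ → nonzero-on-diagonal a ; offDiagonal≈0 = offDiagonal≈0 }
                          decomposition >>= λ bound →
    return (subst₂ _≤_ (Subset.∣⊤∣≡n n) |Rs|≡r bound))
  where
  open OverField F hiding (zero; _-_)
  open SliceRank F
  open PartitionIndicator F
  open import Algebra.Properties.Ring ring using (-0#≈0#; -‿involutive)

  decomposition : Decomposition (λ x → I f x * T x)
  decomposition = record
    { terms    = Rs
    ; products = All.map partitionRankOne⇒twoBlockProduct rank-one
    ; D≈sum    = I·T≈∑Rs
    }

  nonzero-on-diagonal : ∀ a → ¬ I f (replicate (suc k) a) * T (replicate (suc k) a) ≈ 0#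
  nonzero-on-diagonal a I·T≈0 = ∑≉0 (begin
    S                          ≈⟨ -‿involutive S ⟨
    - - S                      ≈⟨ -‿cong (I-top f x (hasPartition-top a)) ⟨
    - I f x                    ≈⟨ -‿cong (*-identityʳ (I f x)) ⟨
    - (I f x * 1#)             ≈⟨ -‿cong (*-congˡ (proj₁ (T-indicator x) (P-diagonal a))) ⟨
    - (I f x * T x)            ≈⟨ -‿cong I·T≈0 ⟩
    - 0#                       ≈⟨ -0#≈0# ⟩
    0#                         ∎)
    where
    open import Relation.Binary.Reasoning.Setoid setoid
    x = replicate (suc k) a
    S = ΣΠ (suc k) (_≺? top (suc k)) (λ π → f π * ℤ→F (μ π (top (suc k))))

  vanishes-off-diagonal : ∀ x → DoubleNegation (NonConstant x → I f x * T x ≈ 0#)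
  vanishes-off-diagonal x = ¬¬-excluded-middle {A = P x} >>= λ where
    (yes Px) → return λ nonConstant → let σ≢1̂ = λ σ≡1̂ → nonConstant _ (partitionOf≡top⇒constant x σ≡1̂) in
      trans (*-congʳ (trans (I-below-top f x (partitionOf-isSetPartition x) (hasPartition-partitionOf x) σ≢1̂)
        (f-vanishes _ (partitionOf-isSetPartition x) σ≢1̂ (x , hasPartition-partitionOf x , Px)))) (zeroˡ _)
    (no ¬Px) → return λ _ → trans (*-congˡ (proj₂ (T-indicator x) ¬Px)) (zeroʳ _)
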